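{- Let $p,q$ be natural numbers with $pq\ge 6$ and $\Delta^+=\mathbb{Z}_p*\mathbb{Z}_q$. For $n\ge0$ let $s_f(n)$ be the number of free subgroups of index $n$ in $\Delta^+$. Then $$\sum_{n\ge0}s_f(n)\,z^n=\sum_{n\ge0}|\mathfrak{H}^r_{p,q}(n)|\,z^n .$$
   Context: An oriented labelled hypermap on $[n]$ is a triple $\langle [n];\alpha,\varphi\rangle$ with $\alpha,\varphi\in\mathfrak{S}_n$; it is connected if $\langle\alpha,\varphi\rangle$ is transitive on $[n]$, and is a $(p,q)$-hypermap if all disjoint cycles of $\alpha$ have length exactly $p$ and all disjoint cycles of $\varphi$ have length exactly $q$. A rooted hypermap has root dart $1$; two rooted hypermaps are isomorphic if they are simultaneously conjugate by a permutation $\psi\in\mathfrak{S}_n$ with $\psi(1)=1$. $\mathfrak{H}^r_{p,q}(n)$ is the set of isomorphism classes of connected rooted $(p,q)$-hypermaps on $n$ darts ($\mathfrak{H}^r_{p,q}(0)=\emptyset$). -}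

module Defs where

open import Level using (Level; _⊔_) renaming (suc to lsuc; zero to lzero)
open import Data.Nat using (ℕ; zero; suc; _<_; _∸_)
open import Data.Fin using (Fin) renaming (zero to fzero)
open import Data.Fin.Permutation using (Permutation′; _⟨$⟩ʳ_; _⟨$⟩ˡ_)
open import Data.List using (List; []; _∷_; _++_; replicate)
open import Data.Bool using (Bool; true; false; not)
open import Data.Product using (Σ; _×_; _,_; ∃)
open import Data.Empty using (⊥)
open import Relation.Binary.PropositionalEquality using (_≡_; _≢_)
open import Function.Bundles using (_⇔_)

-- Counting equivalence classes: "the quotient of A by R has exactly k
-- elements", witnessed by a surjection A → Fin k whose fibres are
-- exactly the R-classes.

NumClasses : ∀ {a r} (A : Set a) (R : A → A → Set r) (k : ℕ) → Set (a ⊔ r)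
NumClasses A R k =
  Σ (A → Fin k) λ f →
    (∀ (j : Fin k) → ∃ λ x → f x ≡ j) ×
    (∀ x y → (f x ≡ f y) ⇔ R x y)

-- The group Δ⁺ = ℤ_p * ℤ_q, given by the presentation
-- ⟨ a , b ∣ a^p = 1 , b^q = 1 ⟩ (as a monoid presentation; inverses
-- are a⁻¹ = a^(p-1), b⁻¹ = b^(q-1)).

module Δ (p q : ℕ) where

  data Gen : Set where
    a b : Gen

  Word : Set
  Word = List Gen

  data Rel : Word → Word → Set where
    rel-a : Rel (replicate p a) []
    rel-b : Rel (replicate q b) []

  data _≈_ : Word → Word → Set where
    ≈-refl  : ∀ {u} → u ≈ u
    ≈-sym   : ∀ {u v} → u ≈ v → v ≈ u
    ≈-trans : ∀ {u v w} → u ≈ v → v ≈ w → u ≈ w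
    ≈-rel   : ∀ u v {w₁ w₂} → Rel w₁ w₂ → (u ++ (w₁ ++ v)) ≈ (u ++ (w₂ ++ v))

  invGen : Gen → Word
  invGen a = replicate (p ∸ 1) a
  invGen b = replicate (q ∸ 1) b

  inv : Word → Word
  inv []      = []
  inv (g ∷ w) = inv w ++ invGen g

  record IsSubgroup (H : Word → Set) : Set where
    field
      resp  : ∀ {u v} → u ≈ v → H u → H v
      one   : H []
      mul   : ∀ {u v} → H u → H v → H (u ++ v)
      inver : ∀ {u} → H u → H (inv u)

  -- H has index n: there are exactly n right cosets H u
  -- (H u = H v  iff  u v⁻¹ ∈ H)
  HasIndex : (H : Word → Set) → ℕ → Set
  HasIndex H n = NumClasses Word (λ u v → H (u ++ inv v)) n

  -- the free group on a set X: words in X^{±1}; reduced words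
  FWord : Set → Set
  FWord X = List (X × Bool)

  Reduced : {X : Set} → FWord X → Set
  Reduced {X} u = ∀ (pre suf : FWord X) (x : X) (e : Bool) →
                  u ≢ pre ++ ((x , e) ∷ (x , not e) ∷ suf)

  ext : {X : Set} → (X → Word) → FWord X → Word
  ext g []                 = []
  ext g ((x , true)  ∷ u)  = g x ++ ext g u
  ext g ((x , false) ∷ u)  = inv (g x) ++ ext g u

  -- H is free: there is a set X and g : X → H such that the induced
  -- homomorphism F(X) → H is an isomorphism (g is a free basis of H):
  -- it lands in H, is onto H, and has trivial kernel (no nonempty
  -- reduced word maps to the identity).
  IsFree : (H : Word → Set) → Set₁
  IsFree H = Σ Set λ X → Σ (X → Word) λ g →
    (∀ x → H (g x)) ×
    (∀ w → H w → ∃ λ (u : FWord X) → ext g u ≈ w) ×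
    (∀ (u : FWord X) → Reduced u → ext g u ≈ [] → u ≡ [])

  FreeSubgroupOfIndex : ℕ → Set₁
  FreeSubgroupOfIndex n =
    Σ (Word → Set) λ H → IsSubgroup H × HasIndex H n × IsFree H

  SameSubgroup : ∀ {n} → FreeSubgroupOfIndex n → FreeSubgroupOfIndex n → Set
  SameSubgroup (H , _) (K , _) = ∀ w → H w ⇔ K w

iter : ∀ {n} → Permutation′ n → ℕ → Fin n → Fin n
iter σ zero    i = i
iter σ (suc k) i = σ ⟨$⟩ʳ iter σ k i

AllCyclesLength : ∀ {n} → Permutation′ n → ℕ → Set
AllCyclesLength {n} σ p = ∀ (i : Fin n) →
  iter σ p i ≡ i × (∀ k → 0 < k → k < p → iter σ k i ≢ i)

data Reach {n} (α φ : Permutation′ n) : Fin n → Fin n → Set where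
  here  : ∀ {i} → Reach α φ i i
  stepα  : ∀ {i j} → Reach α φ (α ⟨$⟩ʳ i) j → Reach α φ i j
  stepα⁻ : ∀ {i j} → Reach α φ (α ⟨$⟩ˡ i) j → Reach α φ i j
  stepφ  : ∀ {i j} → Reach α φ (φ ⟨$⟩ʳ i) j → Reach α φ i j
  stepφ⁻ : ∀ {i j} → Reach α φ (φ ⟨$⟩ˡ i) j → Reach α φ i j

Transitive : ∀ {n} → Permutation′ n → Permutation′ n → Set
Transitive {n} α φ = ∀ (i j : Fin n) → Reach α φ i j

-- connected (p,q)-hypermap on darts Fin (suc m) (dart 1 = fzero is the root)
record PQHypermap (p q m : ℕ) : Set where
  field
    α φ       : Permutation′ (suc m)
    connected : Transitive α φ
    α-cycles  : AllCyclesLength α p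
    φ-cycles  : AllCyclesLength φ q

RootedHypermap : ℕ → ℕ → ℕ → Set
RootedHypermap p q zero    = ⊥
RootedHypermap p q (suc m) = PQHypermap p q m

RootedIso : ∀ p q n → RootedHypermap p q n → RootedHypermap p q n → Set
RootedIso p q zero    () _
RootedIso p q (suc m) H K =
  Σ (Permutation′ (suc m)) λ ψ →
    (ψ ⟨$⟩ʳ fzero ≡ fzero) ×
    (∀ i → ψ ⟨$⟩ʳ (PQHypermap.α H ⟨$⟩ʳ i) ≡ PQHypermap.α K ⟨$⟩ʳ (ψ ⟨$⟩ʳ i)) ×
    (∀ i → ψ ⟨$⟩ʳ (PQHypermap.φ H ⟨$⟩ʳ i) ≡ PQHypermap.φ K ⟨$⟩ʳ (ψ ⟨$⟩ʳ i))

-- A subgroup H of Δ⁺ = ⟨a, b ∣ aᵖ, bᵠ⟩ of index n acts on its n right cosets, with a root H, and a, b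
-- act by permutations α, φ; the action is transitive.  If H is free, it is torsion-free, so no conjugate
-- u aᵏ u⁻¹ (0 < k < p) or u bᵏ u⁻¹ (0 < k < q) lies in H: every cycle of α has length p and every cycle of
-- φ length q, and the coset action is a rooted (p,q)-hypermap.  Conversely the root stabiliser of a
-- (p,q)-hypermap is free by Reidemeister–Schreier: a spanning tree of the darts gives a Schreier
-- transversal, the relators aᵖ, bᵠ say that the Schreier generators along each cycle multiply to 1, and
-- the generators of the non-tree edges, less one edge per cycle, form a free basis.  Rooted hypermaps are
-- isomorphic exactly when their root stabilisers coincide, so both sides count the classes of the
-- finitely many rooted (p,q)-hypermaps on n darts.
--
-- A free basis is an arbitrary type, so words over it cannot be reduced effectively; torsion-freeness
-- is proved under double negation, which suffices because it is only used to refute fixed points.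

module Submission where

open import Defs

open import Level using () renaming (zero to lzero)
open import Function using (_∘_)
open import Function.Bundles using (_⇔_; mk⇔; Equivalence)
import Function.Properties.Equivalence as Equiv
open import Data.Empty using (⊥-elim)
open import Data.Bool using (Bool; true; false; not; _∨_; T; if_then_else_)
open import Data.Bool.Properties using (not-involutive; T-irrelevant)
import Data.Bool.Properties as Bool
open import Data.Product using (Σ; _×_; _,_; proj₁; proj₂; ∃; ∃₂)
open import Data.Product.Properties using (≡-dec)
open import Data.Sum using (_⊎_; inj₁; inj₂; [_,_]′)
open import Data.Maybe using (Maybe; just; nothing; is-nothing)
import Data.Maybe as Maybe
open import Data.Maybe.Properties using (just-injective)
import Data.Maybe.Properties as Maybe
import Data.Maybe.Relation.Unary.Any as MaybeAny
open import Data.Nat using (ℕ; zero; suc; _+_; _*_; _∸_; _<_; _≤_; z≤n; s≤s; _<?_)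
open import Data.Nat.Properties
  using ( m≤m+n; *-comm; *-zeroʳ; ≤-antisym; <-irrefl; <-≤-trans; <⇒≤; m+[n∸m]≡n; ≤-pred; ≤-refl; ≤-trans
        ; m≤n⇒m≤1+n; n<1+n; m<n⇒m<1+n; n≮0; m≤n⇒m<n∨m≡n; +-commutativeSemigroup )
open import Data.Nat.DivMod using (_%_; _/_; m≡m%n+[m/n]*n; m%n<n; %-distribˡ-+; m%n%n≡m%n; n%n≡0; m<n⇒m%n≡m)
open import Data.Nat.Induction using (<-wellFounded)
open import Data.Fin using (Fin; suc; punchOut) renaming (zero to fzero)
open import Data.Fin.Properties using (_≟_; any?; all?; injective⇒≤; punchOut-injective)
open import Data.Fin.Permutation using (Permutation′; _⟨$⟩ʳ_; _⟨$⟩ˡ_; permutation; transpose)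
  renaming (inverseˡ to inverseˡ′; inverseʳ to inverseʳ′)
import Data.Fin.Permutation as Perm
open import Data.Vec.Functional using () renaming (_∷_ to _∷ᶠ_)
open import Data.List
  using ( List; []; _∷_; _++_; _∷ʳ_; [_]; replicate; length; foldr; applyUpTo; initLast; _∷ʳ′_
        ; lookup; deduplicate; allFin; cartesianProductWith; cartesianProduct; mapMaybe )
open import Data.List.Properties using (++-assoc; ++-identityʳ; length-++; ∷-injectiveʳ)
open import Data.List.Relation.Unary.Any using (Any; here; there)
import Data.List.Relation.Unary.Any as Any
import Data.List.Relation.Unary.Any.Properties as Any
import Data.List.Relation.Unary.All as All
open import Data.List.Relation.Unary.Unique.Setoid using (Unique; _∷_)
open import Data.List.Relation.Unary.Unique.DecSetoid.Properties using (deduplicate-!)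
open import Data.List.Membership.Propositional using (find; lose)
open import Data.List.Membership.Propositional.Properties
  using (∈-applyUpTo⁺; ∈-applyUpTo⁻; ∈-allFin; ∈-cartesianProductWith⁺; ∈-cartesianProduct⁺)
open import Data.List.Extrema.Nat using (argmin; f[argmin]≤f[xs]; argmin-sel)
open import Induction.WellFounded using (Acc; acc)
open import Effect.Monad using (RawMonad)
open import Relation.Nullary using (¬_; Dec; yes; no)
open import Relation.Nullary.Negation using (DoubleNegation; ¬¬-Monad)
open import Relation.Nullary.Decidable
  using ( _⊎-dec_; _×-dec_; _→-dec_; ¬?; map′; dec⇒maybe; ¬¬-excluded-middle; dec-true
        ; toWitness; fromWitness; ⌊_⌋; T? )
open import Relation.Binary.Definitions using (DecidableEquality)
open import Relation.Binary.Structures using (IsEquivalence)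
open import Relation.Binary.Bundles using (Setoid; DecSetoid)
open import Relation.Binary.PropositionalEquality
  using (_≡_; _≢_; refl; sym; trans; cong; cong₂; subst; subst₂; module ≡-Reasoning)
import Relation.Binary.Reasoning.Setoid as SetoidReasoning
open import Algebra.Bundles using (Group)
import Algebra.Definitions.RawMonoid as RawMonoidDefs
import Algebra.Properties.Group as GroupProperties
import Algebra.Properties.Monoid.Mult as MonoidMult
open import Algebra.Properties.CommutativeSemigroup +-commutativeSemigroup using (x∙yz≈y∙xz)

replicate-∷ʳ : ∀ {A : Set} k (x : A) → replicate k x ++ [ x ] ≡ x ∷ replicate k x
replicate-∷ʳ zero    x = refl
replicate-∷ʳ (suc k) x = cong (x ∷_) (replicate-∷ʳ k x)

replicate-+ : ∀ {A : Set} m n (x : A) → replicate (m + n) x ≡ replicate m x ++ replicate n x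
replicate-+ zero    n x = refl
replicate-+ (suc m) n x = cong (x ∷_) (replicate-+ m n x)

listGroup : ∀ {A : Set} (_≈_ : List A → List A → Set) → IsEquivalence _≈_ →
  (∀ x {u v} → u ≈ v → (x ++ u) ≈ (x ++ v)) → (∀ y {u v} → u ≈ v → (u ++ y) ≈ (v ++ y)) →
  (inv : List A → List A) → (∀ w → (inv w ++ w) ≈ []) → (∀ w → (w ++ inv w) ≈ []) →
  Group lzero lzero
listGroup {A} _≈_ isEq congˡ congʳ inv invˡ invʳ = record
  { Carrier = List A ; _≈_ = _≈_ ; _∙_ = _++_ ; ε = [] ; _⁻¹ = inv
  ; isGroup = record
    { isMonoid = record
      { isSemigroup = record
        { isMagma = record { isEquivalence = isEq ; ∙-cong = ∙-cong }
        ; assoc = λ x y z → ≡⇒≈ (++-assoc x y z) }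
      ; identity = (λ x → refl′) , (λ x → ≡⇒≈ (++-identityʳ x)) }
    ; inverse = invˡ , invʳ
    ; ⁻¹-cong = ⁻¹-cong } }
  where
    open IsEquivalence isEq renaming (refl to refl′; sym to sym′; trans to trans′)
    ≡⇒≈ : ∀ {u v} → u ≡ v → u ≈ v
    ≡⇒≈ refl = refl′
    ∙-cong : ∀ {u u′ v v′} → u ≈ u′ → v ≈ v′ → (u ++ v) ≈ (u′ ++ v′)
    ∙-cong {u′ = u′} {v = v} e f = trans′ (congʳ v e) (congˡ u′ f)
    ⁻¹-cong : ∀ {u v} → u ≈ v → inv u ≈ inv v
    ⁻¹-cong {u} {v} e = trans′ (sym′ (≡⇒≈ (++-identityʳ (inv u))))
      (trans′ (congˡ (inv u) (sym′ (invʳ v)))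
      (trans′ (≡⇒≈ (sym (++-assoc (inv u) v (inv v))))
      (trans′ (congʳ (inv v) (trans′ (congˡ (inv u) (sym′ e)) (invˡ u))) refl′)))

module Conjugation {c ℓ} (G : Group c ℓ) where
  open Group G
  open RawMonoidDefs rawMonoid using () renaming (_×_ to _×ᴹ_)
  open SetoidReasoning setoid

  ×-conj : ∀ n g h → n ×ᴹ (g ∙ h ∙ g ⁻¹) ≈ g ∙ n ×ᴹ h ∙ g ⁻¹
  ×-conj zero    g h = begin
    ε              ≈⟨ inverseʳ g ⟨
    g ∙ g ⁻¹       ≈⟨ ∙-congʳ (identityʳ g) ⟨
    g ∙ ε ∙ g ⁻¹   ∎
  ×-conj (suc n) g h = begin
    g ∙ h ∙ g ⁻¹ ∙ n ×ᴹ (g ∙ h ∙ g ⁻¹)       ≈⟨ ∙-congˡ (×-conj n g h) ⟩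
    g ∙ h ∙ g ⁻¹ ∙ (g ∙ n ×ᴹ h ∙ g ⁻¹)       ≈⟨ assoc (g ∙ h) (g ⁻¹) _ ⟩
    g ∙ h ∙ (g ⁻¹ ∙ (g ∙ n ×ᴹ h ∙ g ⁻¹))     ≈⟨ ∙-congˡ (∙-congˡ (assoc g (n ×ᴹ h) (g ⁻¹))) ⟩
    g ∙ h ∙ (g ⁻¹ ∙ (g ∙ (n ×ᴹ h ∙ g ⁻¹)))   ≈⟨ ∙-congˡ (\\-leftDividesʳ g _) ⟩
    g ∙ h ∙ (n ×ᴹ h ∙ g ⁻¹)                  ≈⟨ assoc (g ∙ h) (n ×ᴹ h) (g ⁻¹) ⟨
    g ∙ h ∙ n ×ᴹ h ∙ g ⁻¹                    ≈⟨ ∙-congʳ (assoc g h (n ×ᴹ h)) ⟩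
    g ∙ (h ∙ n ×ᴹ h) ∙ g ⁻¹                  ∎
    where open GroupProperties G using (\\-leftDividesʳ)

  conj≈ε⇒≈ε : ∀ g h → g ∙ h ∙ g ⁻¹ ≈ ε → h ≈ ε
  conj≈ε⇒≈ε g h e = begin
    h                 ≈⟨ \\-leftDividesʳ g h ⟨
    g ⁻¹ ∙ (g ∙ h)    ≈⟨ ∙-congˡ (x∙y⁻¹≈ε⇒x≈y (g ∙ h) g e) ⟩
    g ⁻¹ ∙ g          ≈⟨ inverseˡ g ⟩
    ε                 ∎
    where open GroupProperties G using (\\-leftDividesʳ; x∙y⁻¹≈ε⇒x≈y)

module _ {A : Set} {R : A → A → Set} (isEquivalence : IsEquivalence R) (R? : ∀ x y → Dec (R x y)) where
  open IsEquivalence isEquivalence renaming (refl to R-refl; sym to R-sym; trans to R-trans)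

  private
    decSetoid : DecSetoid lzero lzero
    decSetoid = record { isDecEquivalence = record { isEquivalence = isEquivalence ; _≟_ = R? } }

    index-unique : ∀ {xs a b} → Unique (DecSetoid.setoid decSetoid) xs →
                   (p : Any (R a) xs) (q : Any (R b) xs) → R a b → Any.index p ≡ Any.index q
    index-unique _            (here _)  (here _)  _   = refl
    index-unique (x≉ ∷ _)     (here aRx) (there q) aRb =
      let x≉y , bRy = All.lookupAny x≉ q in ⊥-elim (x≉y (R-trans (R-sym aRx) (R-trans aRb bRy)))
    index-unique (x≉ ∷ _)     (there p) (here bRx) aRb =
      let x≉y , aRy = All.lookupAny x≉ p in ⊥-elim (x≉y (R-trans (R-sym bRx) (R-trans (R-sym aRb) aRy)))
    index-unique (_ ∷ unique) (there p) (there q) aRb = cong suc (index-unique unique p q aRb)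

    any-at : ∀ {P : A → Set} xs i → P (lookup xs i) → Σ (Any P xs) λ p → Any.index p ≡ i
    any-at (x ∷ xs) fzero    px = here px , refl
    any-at (x ∷ xs) (suc i)  px = let p , e = any-at xs i px in there p , cong suc e

  -- Deduplicating a list that meets every class leaves exactly one representative per class.
  numClasses : (xs : List A) → (∀ a → Any (R a) xs) → ∃ λ k → NumClasses A R k
  numClasses xs covers = length reps , class , onto , fibres
    where
      reps = deduplicate R? xs
      unique = deduplicate-! decSetoid xs
      covers′ : ∀ a → Any (R a) reps
      covers′ a = Any.deduplicate⁺ R? (λ yRx aRx → R-trans aRx (R-sym yRx)) (covers a)
      class : A → Fin (length reps)
      class a = Any.index (covers′ a)
      onto : ∀ j → ∃ λ a → class a ≡ j
      onto j = let p , e = any-at {R (lookup reps j)} reps j R-refl in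
        lookup reps j , trans (index-unique unique (covers′ _) p R-refl) e
      fibres : ∀ a b → (class a ≡ class b) ⇔ R a b
      fibres a b = mk⇔
        (λ e → R-trans (Any.lookup-index (covers′ a))
                 (R-sym (subst (λ j → R b (lookup reps j)) (sym e) (Any.lookup-index (covers′ b)))))
        (index-unique unique (covers′ a) (covers′ b))

NumClasses-empty : ∀ {a r} {A : Set a} {R : A → A → Set r} → ¬ A → NumClasses A R 0
NumClasses-empty ¬a = (λ a → ⊥-elim (¬a a)) , (λ ()) , λ a → ⊥-elim (¬a a)

NumClasses-transfer : ∀ {a b r s} {A : Set a} {B : Set b} {R : A → A → Set r} {S : B → B → Set s} (f : A → B) →
  (∀ b → ∃ λ a → S (f a) b) → (∀ x y → S (f x) (f y) ⇔ R x y) → ∀ {k} → NumClasses B S k → NumClasses A R k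
NumClasses-transfer f f-onto f-reflects (class , onto , fibres) =
    class ∘ f
  , (λ j → let b , e = onto j ; a , s = f-onto b in a , trans (Equivalence.from (fibres (f a) b) s) e)
  , λ x y → Equiv.trans (fibres (f x) (f y)) (f-reflects x y)

countTrue : ∀ {n} → (Fin n → Bool) → ℕ
countTrue {zero}  f = 0
countTrue {suc n} f = (if f fzero then 1 else 0) + countTrue (f ∘ suc)

countTrue-≤ : ∀ {n} (f g : Fin n → Bool) → (∀ j → T (g j) → T (f j)) → countTrue g ≤ countTrue f
countTrue-≤ {zero}  f g g⊆f = z≤n
countTrue-≤ {suc n} f g g⊆f with f fzero | g fzero | g⊆f fzero
... | true  | true  | _ = s≤s (countTrue-≤ (f ∘ suc) (g ∘ suc) (g⊆f ∘ suc))
... | true  | false | _ = m≤n⇒m≤1+n (countTrue-≤ (f ∘ suc) (g ∘ suc) (g⊆f ∘ suc))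
... | false | false | _ = countTrue-≤ (f ∘ suc) (g ∘ suc) (g⊆f ∘ suc)
... | false | true  | h = ⊥-elim (h _)

countTrue-< : ∀ {n} (f g : Fin n → Bool) → (∀ j → T (g j) → T (f j)) →
              ∀ j → T (f j) → ¬ T (g j) → countTrue g < countTrue f
countTrue-< {suc n} f g g⊆f fzero fj ¬gj with f fzero | g fzero
... | true  | false = s≤s (countTrue-≤ (f ∘ suc) (g ∘ suc) (g⊆f ∘ suc))
... | true  | true  = ⊥-elim (¬gj _)
... | false | _     = ⊥-elim fj
countTrue-< {suc n} f g g⊆f (suc j) fj ¬gj with f fzero | g fzero | g⊆f fzero
... | true  | true  | _ = s≤s (countTrue-< (f ∘ suc) (g ∘ suc) (g⊆f ∘ suc) j fj ¬gj)
... | true  | false | _ = m≤n⇒m≤1+n (countTrue-< (f ∘ suc) (g ∘ suc) (g⊆f ∘ suc) j fj ¬gj)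
... | false | false | _ = countTrue-< (f ∘ suc) (g ∘ suc) (g⊆f ∘ suc) j fj ¬gj
... | false | true  | h = ⊥-elim (h _)

allFunctions : ∀ n k → List (Fin n → Fin k)
allFunctions zero    k = [ (λ ()) ]
allFunctions (suc n) k = cartesianProductWith _∷ᶠ_ (allFin k) (allFunctions n k)

allFunctions-complete : ∀ n k (f : Fin n → Fin k) → Any (λ g → ∀ i → g i ≡ f i) (allFunctions n k)
allFunctions-complete zero    k f = here λ ()
allFunctions-complete (suc n) k f =
  let g , g∈ , g≗ = find (allFunctions-complete n k (f ∘ suc)) in
  lose (∈-cartesianProductWith⁺ _∷ᶠ_ (∈-allFin (f fzero)) g∈) λ { fzero → refl ; (suc i) → g≗ i }

Injective : ∀ {n} → (Fin n → Fin n) → Set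
Injective f = ∀ {i j} → f i ≡ f j → i ≡ j

injective? : ∀ {n} (f : Fin n → Fin n) → Dec (Injective f)
injective? f = map′ (λ inj {i} {j} → inj i j) (λ inj i j → inj) (all? λ i → all? λ j → (f i ≟ f j) →-dec (i ≟ j))

permutation-injective : ∀ {n} (π : Permutation′ n) {f : Fin n → Fin n} → (∀ i → f i ≡ π ⟨$⟩ʳ i) → Injective f
permutation-injective π f≗π {i} {j} e =
  trans (sym (inverseˡ′ π)) (trans (cong (π ⟨$⟩ˡ_) (trans (sym (f≗π i)) (trans e (f≗π j)))) (inverseˡ′ π))

-- An injection Fin n → Fin n is onto: a missed value would give an injection into Fin (n - 1).
injective⇒permutation : ∀ {n} (f : Fin (suc n) → Fin (suc n)) → Injective f → Permutation′ (suc n)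
injective⇒permutation f inj = permutation f (proj₁ ∘ onto) (proj₂ ∘ onto) (λ i → inj (proj₂ (onto (f i))))
  where
    onto : ∀ y → ∃ λ i → f i ≡ y
    onto y with any? (λ i → f i ≟ y)
    ... | yes found = found
    ... | no  none  = ⊥-elim (<-irrefl refl (injective⇒≤ {f = λ i → punchOut (missed i)}
                                                          (inj ∘ punchOut-injective (missed _) (missed _))))
      where
        missed : ∀ i → y ≢ f i
        missed i e = none (i , sym e)

iter-cong : ∀ {n} (π π′ : Permutation′ n) → (∀ i → π ⟨$⟩ʳ i ≡ π′ ⟨$⟩ʳ i) → ∀ k i → iter π k i ≡ iter π′ k i
iter-cong π π′ e zero    i = refl
iter-cong π π′ e (suc k) i = trans (cong (π ⟨$⟩ʳ_) (iter-cong π π′ e k i)) (e _)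

AllCyclesLength-cong : ∀ {n} (π π′ : Permutation′ n) → (∀ i → π ⟨$⟩ʳ i ≡ π′ ⟨$⟩ʳ i) → ∀ {p} →
                       AllCyclesLength π p → AllCyclesLength π′ p
AllCyclesLength-cong π π′ e {p} cycles i =
    trans (sym (iter-cong π π′ e p i)) (proj₁ (cycles i))
  , λ k 0<k k<p fixed → proj₂ (cycles i) k 0<k k<p (trans (iter-cong π π′ e k i) fixed)

Transitive-cong : ∀ {n} (α φ α′ φ′ : Permutation′ n) →
                  (∀ i → α ⟨$⟩ʳ i ≡ α′ ⟨$⟩ʳ i) → (∀ i → φ ⟨$⟩ʳ i ≡ φ′ ⟨$⟩ʳ i) → Transitive α φ → Transitive α′ φ′
Transitive-cong α φ α′ φ′ eα eφ transitive i j = go (transitive i j)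
  where
    inverse-cong : ∀ (π π′ : Permutation′ _) → (∀ i → π ⟨$⟩ʳ i ≡ π′ ⟨$⟩ʳ i) → ∀ i → π ⟨$⟩ˡ i ≡ π′ ⟨$⟩ˡ i
    inverse-cong π π′ e i = trans (sym (inverseˡ′ π′)) (cong (π′ ⟨$⟩ˡ_) (trans (sym (e _)) (inverseʳ′ π)))
    go : ∀ {i j} → Reach α φ i j → Reach α′ φ′ i j
    go here       = here
    go (stepα r)  = stepα  (subst (λ x → Reach α′ φ′ x _) (eα _) (go r))
    go (stepφ r)  = stepφ  (subst (λ x → Reach α′ φ′ x _) (eφ _) (go r))
    go (stepα⁻ r) = stepα⁻ (subst (λ x → Reach α′ φ′ x _) (inverse-cong α α′ eα _) (go r))
    go (stepφ⁻ r) = stepφ⁻ (subst (λ x → Reach α′ φ′ x _) (inverse-cong φ φ′ eφ _) (go r))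

AllCyclesLength? : ∀ {n} (π : Permutation′ n) p → Dec (AllCyclesLength π p)
AllCyclesLength? π p = all? λ i → (iter π p i ≟ i)
  ×-dec map′ (λ h k 0<k k<p → h k k<p 0<k) (λ h k k<p 0<k → h k 0<k k<p)
             (allBelow? (λ k → (0 <? k) →-dec ¬? (iter π k i ≟ i)) p)
  where
    allBelow? : ∀ {P : ℕ → Set} → (∀ k → Dec (P k)) → ∀ n → Dec (∀ k → k < n → P k)
    allBelow? P? zero    = yes λ _ ()
    allBelow? P? (suc n) with allBelow? P? n | P? n
    ... | yes below | yes at = yes λ k k<1+n → [ below k , (λ { refl → at }) ]′ (m≤n⇒m<n∨m≡n (≤-pred k<1+n))
    ... | yes _     | no ¬at = no λ all → ¬at (all n ≤-refl)
    ... | no ¬below | _      = no λ all → ¬below (λ k k<n → all k (m<n⇒m<1+n k<n))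

-- The group Δ⁺

module Δ-Group (p₀ q₀ : ℕ) where
  open Δ (suc p₀) (suc q₀)

  ≡⇒≈ : ∀ {u v} → u ≡ v → u ≈ v
  ≡⇒≈ refl = ≈-refl

  ≈-congˡ : ∀ x {u v} → u ≈ v → (x ++ u) ≈ (x ++ v)
  ≈-congˡ x ≈-refl        = ≈-refl
  ≈-congˡ x (≈-sym e)     = ≈-sym (≈-congˡ x e)
  ≈-congˡ x (≈-trans e f) = ≈-trans (≈-congˡ x e) (≈-congˡ x f)
  ≈-congˡ x (≈-rel u v {w₁} {w₂} r) =
    ≈-trans (≡⇒≈ (sym (++-assoc x u (w₁ ++ v))))
      (≈-trans (≈-rel (x ++ u) v r) (≡⇒≈ (++-assoc x u (w₂ ++ v))))

  ≈-congʳ : ∀ y {u v} → u ≈ v → (u ++ y) ≈ (v ++ y)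
  ≈-congʳ y ≈-refl        = ≈-refl
  ≈-congʳ y (≈-sym e)     = ≈-sym (≈-congʳ y e)
  ≈-congʳ y (≈-trans e f) = ≈-trans (≈-congʳ y e) (≈-congʳ y f)
  ≈-congʳ y (≈-rel u v {w₁} {w₂} r) =
    ≈-trans (≡⇒≈ (reassoc w₁)) (≈-trans (≈-rel u (v ++ y) r) (≡⇒≈ (sym (reassoc w₂))))
    where
      reassoc : ∀ w → (u ++ (w ++ v)) ++ y ≡ u ++ (w ++ (v ++ y))
      reassoc w = trans (++-assoc u (w ++ v) y) (cong (u ++_) (++-assoc w v y))

  relator⇒≈ : ∀ {w₁ w₂} → Rel w₁ w₂ → w₁ ≈ w₂
  relator⇒≈ {w₁} {w₂} r =
    ≈-trans (≡⇒≈ (sym (++-identityʳ w₁))) (≈-trans (≈-rel [] [] r) (≡⇒≈ (++-identityʳ w₂)))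

  invGen-inverseˡ : ∀ g → (invGen g ++ [ g ]) ≈ []
  invGen-inverseˡ a = ≈-trans (≡⇒≈ (replicate-∷ʳ p₀ a)) (relator⇒≈ rel-a)
  invGen-inverseˡ b = ≈-trans (≡⇒≈ (replicate-∷ʳ q₀ b)) (relator⇒≈ rel-b)

  invGen-inverseʳ : ∀ g → (g ∷ invGen g) ≈ []
  invGen-inverseʳ a = relator⇒≈ rel-a
  invGen-inverseʳ b = relator⇒≈ rel-b

  inv-++ : ∀ u v → inv (u ++ v) ≡ inv v ++ inv u
  inv-++ []      v = sym (++-identityʳ (inv v))
  inv-++ (g ∷ u) v = trans (cong (_++ invGen g) (inv-++ u v)) (++-assoc (inv v) (inv u) (invGen g))

  inverseʳ : ∀ w → (w ++ inv w) ≈ []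
  inverseʳ []      = ≈-refl
  inverseʳ (g ∷ w) = ≈-trans (≡⇒≈ (cong (g ∷_) (sym (++-assoc w (inv w) (invGen g)))))
    (≈-trans (≈-congˡ [ g ] (≈-congʳ (invGen g) (inverseʳ w))) (invGen-inverseʳ g))

  inverseˡ : ∀ w → (inv w ++ w) ≈ []
  inverseˡ []      = ≈-refl
  inverseˡ (g ∷ w) = ≈-trans (≡⇒≈ reassoc)
    (≈-trans (≈-congˡ (inv w) (≈-congʳ w (invGen-inverseˡ g))) (inverseˡ w))
    where
      reassoc : (inv w ++ invGen g) ++ g ∷ w ≡ inv w ++ ((invGen g ++ [ g ]) ++ w)
      reassoc = trans (++-assoc (inv w) (invGen g) (g ∷ w))
                      (cong (inv w ++_) (sym (++-assoc (invGen g) [ g ] w)))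

  Δ-group : Group lzero lzero
  Δ-group = listGroup _≈_ (record { refl = ≈-refl ; sym = ≈-sym ; trans = ≈-trans })
    ≈-congˡ ≈-congʳ inv inverseˡ inverseʳ

  open RawMonoidDefs (Group.rawMonoid Δ-group) public using () renaming (_×_ to _×ᵂ_)

module GeneratorOrders (p₀ q₀ : ℕ) where
  open Δ (suc p₀) (suc q₀)
  open Δ-Group p₀ q₀

  order₀ : Gen → ℕ
  order₀ a = p₀
  order₀ b = q₀

  order : Gen → ℕ
  order l = suc (order₀ l)

  _≟ᴳ_ : DecidableEquality Gen
  a ≟ᴳ a = yes refl
  a ≟ᴳ b = no λ ()
  b ≟ᴳ a = no λ ()
  b ≟ᴳ b = yes refl

  relator : ∀ l → Rel (replicate (order l) l) []
  relator a = rel-a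
  relator b = rel-b

  count : Gen → Word → ℕ
  count l []       = 0
  count l (l′ ∷ w) with l ≟ᴳ l′
  ... | yes _ = suc (count l w)
  ... | no  _ = count l w

  count-++ : ∀ l u v → count l (u ++ v) ≡ count l u + count l v
  count-++ l []       v = refl
  count-++ l (l′ ∷ u) v with l ≟ᴳ l′
  ... | yes _ = cong suc (count-++ l u v)
  ... | no  _ = count-++ l u v

  count-replicate-self : ∀ l k → count l (replicate k l) ≡ k
  count-replicate-self l zero = refl
  count-replicate-self l (suc k) with l ≟ᴳ l
  ... | yes _ = cong suc (count-replicate-self l k)
  ... | no ne = ⊥-elim (ne refl)

  count-replicate-other : ∀ {l l′} → l ≢ l′ → ∀ k → count l (replicate k l′) ≡ 0
  count-replicate-other ne zero = refl
  count-replicate-other {l} {l′} ne (suc k) with l ≟ᴳ l′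
  ... | yes e = ⊥-elim (ne e)
  ... | no  _ = count-replicate-other ne k

  count-relator : ∀ l l′ → count l (replicate (order l′) l′) % order l ≡ 0
  count-relator l l′ = by-cases (l ≟ᴳ l′)
    where
      by-cases : Dec (l ≡ l′) → count l (replicate (order l′) l′) % order l ≡ 0
      by-cases (yes refl) = trans (cong (_% order l) (count-replicate-self l (order l))) (n%n≡0 (order l))
      by-cases (no ne)    = cong (_% order l) (count-replicate-other ne (order l′))

  count-insert : ∀ l u v {w} → count l w % order l ≡ 0 →
                 count l (u ++ w ++ v) % order l ≡ count l (u ++ v) % order l
  count-insert l u v {w} w≡0 = begin
    count l (u ++ w ++ v) % order l                  ≡⟨ cong (_% order l) split ⟩
    (count l w + count l (u ++ v)) % order l         ≡⟨ %-distribˡ-+ (count l w) _ (order l) ⟩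
    (count l w % order l + count l (u ++ v) % order l) % order l
                                      ≡⟨ cong (λ x → (x + count l (u ++ v) % order l) % order l) w≡0 ⟩
    count l (u ++ v) % order l % order l             ≡⟨ m%n%n≡m%n (count l (u ++ v)) (order l) ⟩
    count l (u ++ v) % order l                       ∎
    where
      open ≡-Reasoning
      split : count l (u ++ w ++ v) ≡ count l w + count l (u ++ v)
      split = begin
        count l (u ++ w ++ v)                  ≡⟨ count-++ l u (w ++ v) ⟩
        count l u + count l (w ++ v)           ≡⟨ cong (count l u +_) (count-++ l w v) ⟩
        count l u + (count l w + count l v)    ≡⟨ x∙yz≈y∙xz (count l u) (count l w) (count l v) ⟩
        count l w + (count l u + count l v)    ≡⟨ cong (count l w +_) (count-++ l u v) ⟨
        count l w + count l (u ++ v)           ∎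

  count-≈ : ∀ l {u v} → u ≈ v → count l u % order l ≡ count l v % order l
  count-≈ l ≈-refl                = refl
  count-≈ l (≈-sym e)             = sym (count-≈ l e)
  count-≈ l (≈-trans e f)         = trans (count-≈ l e) (count-≈ l f)
  count-≈ l (≈-rel u v rel-a)     = count-insert l u v (count-relator l a)
  count-≈ l (≈-rel u v rel-b)     = count-insert l u v (count-relator l b)

  replicate≉[] : ∀ l k → 0 < k → k < order l → ¬ (replicate k l ≈ [])
  replicate≉[] l (suc k) _ k<o e with trans (sym (m<n⇒m%n≡m k<o))
    (trans (cong (_% order l) (sym (count-replicate-self l (suc k)))) (count-≈ l e))
  ... | ()

  relator-multiple : ∀ l k → replicate (k * order l) l ≈ []
  relator-multiple l zero    = ≈-refl
  relator-multiple l (suc k) = ≈-trans (≡⇒≈ (replicate-+ (order l) (k * order l) l))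
    (≈-trans (≈-congʳ _ (relator⇒≈ (relator l))) (relator-multiple l k))

  ×ᵂ-replicate : ∀ n k l → n ×ᵂ replicate k l ≡ replicate (n * k) l
  ×ᵂ-replicate zero    k l = refl
  ×ᵂ-replicate (suc n) k l = trans (cong (replicate k l ++_) (×ᵂ-replicate n k l)) (sym (replicate-+ k (n * k) l))

-- Free groups

module FreeGroup (X : Set) where

  Letter : Set
  Letter = X × Bool

  FreeWord : Set
  FreeWord = List Letter

  opp : Letter → Letter
  opp (x , e) = x , not e

  opp-involutive : ∀ c → opp (opp c) ≡ c
  opp-involutive (x , e) = cong (x ,_) (not-involutive e)

  ≢-opp : ∀ c → c ≢ opp c
  ≢-opp (x , true)  ()
  ≢-opp (x , false) ()

  infix 4 _∼_
  data _∼_ : FreeWord → FreeWord → Set where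
    ∼-refl   : ∀ {u} → u ∼ u
    ∼-sym    : ∀ {u v} → u ∼ v → v ∼ u
    ∼-trans  : ∀ {u v w} → u ∼ v → v ∼ w → u ∼ w
    ∼-cancel : ∀ pre suf c → pre ++ c ∷ opp c ∷ suf ∼ pre ++ suf

  ∼-setoid : Setoid lzero lzero
  ∼-setoid = record
    { Carrier = FreeWord ; _≈_ = _∼_
    ; isEquivalence = record { refl = ∼-refl ; sym = ∼-sym ; trans = ∼-trans } }

  ≡⇒∼ : ∀ {u v} → u ≡ v → u ∼ v
  ≡⇒∼ refl = ∼-refl

  ∼-cancel′ : ∀ pre suf c → pre ++ opp c ∷ c ∷ suf ∼ pre ++ suf
  ∼-cancel′ pre suf c =
    subst (λ d → pre ++ opp c ∷ d ∷ suf ∼ pre ++ suf) (opp-involutive c) (∼-cancel pre suf (opp c))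

  ∼-congˡ : ∀ x {u v} → u ∼ v → x ++ u ∼ x ++ v
  ∼-congˡ x ∼-refl        = ∼-refl
  ∼-congˡ x (∼-sym e)     = ∼-sym (∼-congˡ x e)
  ∼-congˡ x (∼-trans e f) = ∼-trans (∼-congˡ x e) (∼-congˡ x f)
  ∼-congˡ x (∼-cancel pre suf c) =
    ∼-trans (≡⇒∼ (sym (++-assoc x pre _)))
      (∼-trans (∼-cancel (x ++ pre) suf c) (≡⇒∼ (++-assoc x pre suf)))

  ∼-congʳ : ∀ y {u v} → u ∼ v → u ++ y ∼ v ++ y
  ∼-congʳ y ∼-refl        = ∼-refl
  ∼-congʳ y (∼-sym e)     = ∼-sym (∼-congʳ y e)
  ∼-congʳ y (∼-trans e f) = ∼-trans (∼-congʳ y e) (∼-congʳ y f)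
  ∼-congʳ y (∼-cancel pre suf c) =
    ∼-trans (≡⇒∼ (++-assoc pre _ y))
      (∼-trans (∼-cancel pre (suf ++ y) c) (≡⇒∼ (sym (++-assoc pre suf y))))

  ∼-cong-++ : ∀ {u u′ v v′} → u ∼ u′ → v ∼ v′ → u ++ v ∼ u′ ++ v′
  ∼-cong-++ {u′ = u′} {v = v} e f = ∼-trans (∼-congʳ v e) (∼-congˡ u′ f)

  invᶠ : FreeWord → FreeWord
  invᶠ []      = []
  invᶠ (c ∷ u) = invᶠ u ++ [ opp c ]

  invᶠ-inverseʳ : ∀ u → u ++ invᶠ u ∼ []
  invᶠ-inverseʳ []      = ∼-refl
  invᶠ-inverseʳ (c ∷ u) = begin
    c ∷ (u ++ (invᶠ u ++ [ opp c ]))  ≡⟨ cong (c ∷_) (sym (++-assoc u (invᶠ u) _)) ⟩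
    c ∷ ((u ++ invᶠ u) ++ [ opp c ])  ≈⟨ ∼-congˡ [ c ] (∼-congʳ [ opp c ] (invᶠ-inverseʳ u)) ⟩
    c ∷ opp c ∷ []                    ≈⟨ ∼-cancel [] [] c ⟩
    []                                ∎
    where open SetoidReasoning ∼-setoid

  invᶠ-inverseˡ : ∀ u → invᶠ u ++ u ∼ []
  invᶠ-inverseˡ []      = ∼-refl
  invᶠ-inverseˡ (c ∷ u) = begin
    (invᶠ u ++ [ opp c ]) ++ c ∷ u  ≡⟨ ++-assoc (invᶠ u) [ opp c ] (c ∷ u) ⟩
    invᶠ u ++ opp c ∷ c ∷ u         ≈⟨ ∼-cancel′ (invᶠ u) u c ⟩
    invᶠ u ++ u                     ≈⟨ invᶠ-inverseˡ u ⟩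
    []                              ∎
    where open SetoidReasoning ∼-setoid

  freeGroup : Group lzero lzero
  freeGroup = listGroup _∼_ (Setoid.isEquivalence ∼-setoid)
    ∼-congˡ ∼-congʳ invᶠ invᶠ-inverseˡ invᶠ-inverseʳ

  data IsReduced : FreeWord → Set where
    []-reduced  : IsReduced []
    [-]-reduced : ∀ c → IsReduced [ c ]
    ∷-reduced   : ∀ c d u → d ≢ opp c → IsReduced (d ∷ u) → IsReduced (c ∷ d ∷ u)

  IsReduced-tail : ∀ {c u} → IsReduced (c ∷ u) → IsReduced u
  IsReduced-tail ([-]-reduced c)       = []-reduced
  IsReduced-tail (∷-reduced c d u _ r) = r

  IsReduced-init : ∀ u v → IsReduced (u ++ v) → IsReduced u
  IsReduced-init []          v _ = []-reduced
  IsReduced-init (c ∷ [])    v _ = [-]-reduced c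
  IsReduced-init (c ∷ d ∷ u) v (∷-reduced .c .d ._ ne r) = ∷-reduced c d u ne (IsReduced-init (d ∷ u) v r)

  IsReduced-++ : ∀ u c d v → IsReduced (u ∷ʳ c) → IsReduced (d ∷ v) → d ≢ opp c →
                 IsReduced (u ++ c ∷ d ∷ v)
  IsReduced-++ []          c d v _ rv ne = ∷-reduced c d v ne rv
  IsReduced-++ (x ∷ [])    c d v (∷-reduced .x .c .[] n _) rv ne =
    ∷-reduced x c (d ∷ v) n (∷-reduced c d v ne rv)
  IsReduced-++ (x ∷ y ∷ u) c d v (∷-reduced .x .y ._ n r) rv ne =
    ∷-reduced x y _ n (IsReduced-++ (y ∷ u) c d v r rv ne)

  IsReduced⇒Reduced : ∀ {p q u} → IsReduced u → Δ.Reduced p q u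
  IsReduced⇒Reduced []-reduced      []      suf x e ()
  IsReduced⇒Reduced []-reduced      (_ ∷ _) suf x e ()
  IsReduced⇒Reduced ([-]-reduced c) []          suf x e ()
  IsReduced⇒Reduced ([-]-reduced c) (_ ∷ [])    suf x e ()
  IsReduced⇒Reduced ([-]-reduced c) (_ ∷ _ ∷ _) suf x e ()
  IsReduced⇒Reduced (∷-reduced c d u ne r) []         suf x e refl = ne refl
  IsReduced⇒Reduced {p} {q} (∷-reduced c d u ne r) (_ ∷ pre) suf x e eq =
    IsReduced⇒Reduced {p} {q} r pre suf x e (∷-injectiveʳ eq)

  Reduced⇒IsReduced : ∀ {p q} u → Δ.Reduced p q u → IsReduced u
  Reduced⇒IsReduced []          R = []-reduced
  Reduced⇒IsReduced (c ∷ [])    R = [-]-reduced c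
  Reduced⇒IsReduced {p} {q} (c ∷ d ∷ u) R =
    ∷-reduced c d u (λ { refl → R [] u (proj₁ c) (proj₂ c) refl })
      (Reduced⇒IsReduced {p} {q} (d ∷ u) (λ pre suf x e eq → R (c ∷ pre) suf x e (cong (c ∷_) eq)))

  open RawMonad (¬¬-Monad {lzero}) using (pure; _>>=_)

  ¬¬-reducedForm : ∀ u → DoubleNegation (∃ λ r → IsReduced r × r ∼ u)
  ¬¬-reducedForm []      = pure ([] , []-reduced , ∼-refl)
  ¬¬-reducedForm (c ∷ u) = ¬¬-reducedForm u >>= λ
    { ([] , _ , e) → pure ([ c ] , [-]-reduced c , ∼-congˡ [ c ] e)
    ; (d ∷ r , red , e) → ¬¬-excluded-middle {A = d ≡ opp c} >>= λ
      { (yes refl) → pure (r , IsReduced-tail red , ∼-trans (∼-sym (∼-cancel [] r c)) (∼-congˡ [ c ] e))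
      ; (no ne)    → pure (c ∷ d ∷ r , ∷-reduced c d r ne red , ∼-congˡ [ c ] e) } }

  open RawMonoidDefs (Group.rawMonoid freeGroup) public using () renaming (_×_ to _×ᶠ_)

  data CyclicallyReduced : FreeWord → Set where
    single : ∀ c → CyclicallyReduced [ c ]
    long   : ∀ c s d → IsReduced (c ∷ (s ∷ʳ d)) → d ≢ opp c → CyclicallyReduced (c ∷ (s ∷ʳ d))

  ×-reduced : ∀ n {r} → CyclicallyReduced r → IsReduced (suc n ×ᶠ r)
  ×-reduced zero    (single c)          = [-]-reduced c
  ×-reduced zero    (long c s d red _)  = subst IsReduced (sym (++-identityʳ _)) red
  ×-reduced (suc n) (single c)          = ∷-reduced c c _ (≢-opp c) (×-reduced n (single c))
  ×-reduced (suc n) (long c s d red ne) =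
    subst IsReduced (sym (++-assoc (c ∷ s) [ d ] _))
      (IsReduced-++ (c ∷ s) d c _ red (×-reduced n (long c s d red ne)) ne′)
    where
      ne′ : c ≢ opp d
      ne′ c≡ = ne (trans (sym (opp-involutive d)) (cong opp (sym c≡)))

  private
    inner≢[] : ∀ c s → IsReduced (c ∷ (s ∷ʳ opp c)) → s ≢ []
    inner≢[] c .[] (∷-reduced .c .(opp c) .[] ne _) refl = ne refl

    length-inner : ∀ (c : Letter) s d → length s < length (c ∷ (s ∷ʳ d))
    length-inner c s d = s≤s (subst (length s ≤_) (sym (length-++ s {[ d ]})) (m≤m+n (length s) 1))

    cyclicConjugate : ∀ r → Acc _<_ (length r) → IsReduced r → r ≢ [] →
      DoubleNegation (∃₂ λ s w → CyclicallyReduced s × r ∼ (w ++ s) ++ invᶠ w)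
    cyclicConjugate []      _        _   r≢[] = ⊥-elim (r≢[] refl)
    cyclicConjugate (c ∷ t) (acc rs) red _ with initLast t
    ... | [] = pure ([ c ] , [] , single c , ≡⇒∼ (sym (++-identityʳ [ c ])))
    ... | s ∷ʳ′ d = ¬¬-excluded-middle {A = d ≡ opp c} >>= λ
      { (no ne)    → pure (c ∷ (s ∷ʳ d) , [] , long c s d red ne , ≡⇒∼ (sym (++-identityʳ _)))
      ; (yes refl) → do
          (s′ , w , cr , e) ← cyclicConjugate s (rs (length-inner c s d))
                                (IsReduced-init s [ d ] (IsReduced-tail red)) (inner≢[] c s red)
          pure (s′ , c ∷ w , cr , ∼-trans (∼-congˡ [ c ] (∼-congʳ [ d ] e))
                                    (≡⇒∼ (cong (c ∷_) (++-assoc (w ++ s′) (invᶠ w) [ d ])))) }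

  ¬¬-cyclicallyReducedConjugate : ∀ r → IsReduced r → r ≢ [] →
    DoubleNegation (∃₂ λ s w → CyclicallyReduced s × r ∼ (w ++ s) ++ invᶠ w)
  ¬¬-cyclicallyReducedConjugate r = cyclicConjugate r (<-wellFounded (length r))

  ×ᶠ-nonempty : ∀ n {s} → CyclicallyReduced s → suc n ×ᶠ s ≢ []
  ×ᶠ-nonempty n (single c)       ()
  ×ᶠ-nonempty n (long c s d _ _) ()

  module Normalisation (_≟X_ : DecidableEquality X) where

    _≟ᴸ_ : DecidableEquality Letter
    _≟ᴸ_ = ≡-dec _≟X_ Bool._≟_

    push : Letter → FreeWord → FreeWord
    push c []      = [ c ]
    push c (d ∷ r) with d ≟ᴸ opp c
    ... | yes _ = r
    ... | no  _ = c ∷ d ∷ r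

    normalise : FreeWord → FreeWord
    normalise = foldr push []

    push-reduced : ∀ c {r} → IsReduced r → IsReduced (push c r)
    push-reduced c {[]}    _ = [-]-reduced c
    push-reduced c {d ∷ r} red with d ≟ᴸ opp c
    ... | yes _ = IsReduced-tail red
    ... | no ne = ∷-reduced c d r ne red

    normalise-reduced : ∀ u → IsReduced (normalise u)
    normalise-reduced []      = []-reduced
    normalise-reduced (c ∷ u) = push-reduced c (normalise-reduced u)

    push-cancel : ∀ c {r} → IsReduced r → push c (push (opp c) r) ≡ r
    push-cancel c {[]} _ with opp c ≟ᴸ opp c
    ... | yes _ = refl
    ... | no ne = ⊥-elim (ne refl)
    push-cancel c {d ∷ r} red with d ≟ᴸ opp (opp c)
    push-cancel c {d ∷ []} red | yes e = cong [_] (sym (trans e (opp-involutive c)))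
    push-cancel c {d ∷ d′ ∷ r} (∷-reduced .d .d′ .r ne _) | yes e with d′ ≟ᴸ opp c
    ... | yes e′ = ⊥-elim (ne (trans e′ (cong opp (sym (trans e (opp-involutive c))))))
    ... | no  _  = cong (λ x → x ∷ d′ ∷ r) (sym (trans e (opp-involutive c)))
    push-cancel c {d ∷ r} red | no ne with opp c ≟ᴸ opp c
    ... | yes _  = refl
    ... | no ne′ = ⊥-elim (ne′ refl)

    normalise-++ : ∀ u v → normalise (u ++ v) ≡ foldr push (normalise v) u
    normalise-++ []      v = refl
    normalise-++ (c ∷ u) v = cong (push c) (normalise-++ u v)

    normalise-∼ : ∀ {u v} → u ∼ v → normalise u ≡ normalise v
    normalise-∼ ∼-refl        = refl
    normalise-∼ (∼-sym e)     = sym (normalise-∼ e)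
    normalise-∼ (∼-trans e f) = trans (normalise-∼ e) (normalise-∼ f)
    normalise-∼ (∼-cancel pre suf c) =
      trans (normalise-++ pre (c ∷ opp c ∷ suf))
        (trans (cong (λ r → foldr push r pre) (push-cancel c (normalise-reduced suf))) (sym (normalise-++ pre suf)))

    normalise-reduced-id : ∀ {u} → IsReduced u → normalise u ≡ u
    normalise-reduced-id []-reduced      = refl
    normalise-reduced-id ([-]-reduced c) = refl
    normalise-reduced-id (∷-reduced c d u ne red) rewrite normalise-reduced-id red with d ≟ᴸ opp c
    ... | yes e = ⊥-elim (ne e)
    ... | no  _ = refl

    reduced-∼[] : ∀ {u} → IsReduced u → u ∼ [] → u ≡ []
    reduced-∼[] red e = trans (sym (normalise-reduced-id red)) (normalise-∼ e)

module Extension (p₀ q₀ : ℕ) {X : Set} (g : X → Δ.Word (suc p₀) (suc q₀)) where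
  open Δ (suc p₀) (suc q₀)
  open Δ-Group p₀ q₀
  open FreeGroup X

  ext-++ : ∀ u v → ext g (u ++ v) ≡ ext g u ++ ext g v
  ext-++ []                v = refl
  ext-++ ((x , true)  ∷ u) v = trans (cong (g x ++_) (ext-++ u v)) (sym (++-assoc (g x) (ext g u) (ext g v)))
  ext-++ ((x , false) ∷ u) v = trans (cong (inv (g x) ++_) (ext-++ u v)) (sym (++-assoc (inv (g x)) (ext g u) (ext g v)))

  ext-cancel : ∀ c suf → ext g (c ∷ opp c ∷ suf) ≈ ext g suf
  ext-cancel (x , true)  suf = ≈-trans (≡⇒≈ (sym (++-assoc (g x) (inv (g x)) (ext g suf))))
                                      (≈-congʳ (ext g suf) (inverseʳ (g x)))
  ext-cancel (x , false) suf = ≈-trans (≡⇒≈ (sym (++-assoc (inv (g x)) (g x) (ext g suf))))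
                                      (≈-congʳ (ext g suf) (inverseˡ (g x)))

  ext-∼ : ∀ {u v} → u ∼ v → ext g u ≈ ext g v
  ext-∼ ∼-refl        = ≈-refl
  ext-∼ (∼-sym e)     = ≈-sym (ext-∼ e)
  ext-∼ (∼-trans e f) = ≈-trans (ext-∼ e) (ext-∼ f)
  ext-∼ (∼-cancel pre suf c) = ≈-trans (≡⇒≈ (ext-++ pre (c ∷ opp c ∷ suf)))
    (≈-trans (≈-congˡ (ext g pre) (ext-cancel c suf)) (≡⇒≈ (sym (ext-++ pre suf))))

  ext-invᶠ : ∀ u → ext g (invᶠ u) ≈ inv (ext g u)
  ext-invᶠ u = inverseʳ-unique (ext g u) (ext g (invᶠ u))
    (≈-trans (≡⇒≈ (sym (ext-++ u (invᶠ u)))) (ext-∼ (invᶠ-inverseʳ u)))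
    where open GroupProperties Δ-group using (inverseʳ-unique)

  ext-× : ∀ n u → ext g (n ×ᶠ u) ≡ n ×ᵂ ext g u
  ext-× zero    u = refl
  ext-× (suc n) u = trans (ext-++ u (n ×ᶠ u)) (cong (ext g u ++_) (ext-× n u))

  module _ (injective : ∀ u → Reduced u → ext g u ≈ [] → u ≡ []) where

    -- r is conjugate to a cyclically reduced s, whose powers are reduced and nonempty.
    reduced-notTorsion : ∀ r → IsReduced r → r ≢ [] → ∀ n → ¬ (ext g (suc n ×ᶠ r) ≈ [])
    reduced-notTorsion r red r≢[] n rⁿ≈ε = ¬¬-cyclicallyReducedConjugate r red r≢[] λ
      { (s , w , cr , r∼) → ×ᶠ-nonempty n cr
          (injective (suc n ×ᶠ s) (IsReduced⇒Reduced {suc p₀} {suc q₀} (×-reduced n cr)) (sⁿ≈ε s w r∼)) }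
      where
        sⁿ≈ε : ∀ s w → r ∼ (w ++ s) ++ invᶠ w → ext g (suc n ×ᶠ s) ≈ []
        sⁿ≈ε s w r∼ = conj≈ε⇒≈ε (ext g w) (ext g (suc n ×ᶠ s)) (begin
          (ext g w ++ ext g (suc n ×ᶠ s)) ++ inv (ext g w)      ≈⟨ ≈-congˡ _ (ext-invᶠ w) ⟨
          (ext g w ++ ext g (suc n ×ᶠ s)) ++ ext g (invᶠ w)     ≡⟨ cong (_++ ext g (invᶠ w)) (ext-++ w _) ⟨
          ext g (w ++ suc n ×ᶠ s) ++ ext g (invᶠ w)             ≡⟨ ext-++ (w ++ suc n ×ᶠ s) (invᶠ w) ⟨
          ext g ((w ++ suc n ×ᶠ s) ++ invᶠ w)                   ≈⟨ ext-∼ (×-conj (suc n) w s) ⟨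
          ext g (suc n ×ᶠ ((w ++ s) ++ invᶠ w))                 ≈⟨ ext-∼ (×-congʳ (suc n) r∼) ⟨
          ext g (suc n ×ᶠ r)                                    ≈⟨ rⁿ≈ε ⟩
          []                                                    ∎)
          where
            open SetoidReasoning (Group.setoid Δ-group)
            open Conjugation Δ-group using (conj≈ε⇒≈ε)
            open Conjugation freeGroup using (×-conj)
            open MonoidMult (Group.monoid freeGroup) using (×-congʳ)

module FreeSubgroups (p₀ q₀ : ℕ) where
  open Δ (suc p₀) (suc q₀)
  open Δ-Group p₀ q₀
  open MonoidMult (Group.monoid Δ-group) using (×-congʳ)
  open RawMonad (¬¬-Monad {lzero}) using (pure; _>>=_)

  IsFree⇒¬¬torsionFree : ∀ {H} → IsFree H → ∀ {h} → H h → ∀ n → (suc n ×ᵂ h) ≈ [] → DoubleNegation (h ≈ [])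
  IsFree⇒¬¬torsionFree (X , g , _ , onto , injective) {h} Hh n hⁿ≈ε =
    let x , ext-x≈h = onto h Hh in
    ¬¬-reducedForm x >>= λ
      { ([] , _ , []∼x)      → pure (≈-trans (≈-sym ext-x≈h) (≈-sym (ext-∼ []∼x)))
      ; (c ∷ r , red , r∼x) → λ _ → reduced-notTorsion injective (c ∷ r) red (λ ()) n
          (≈-trans (≡⇒≈ (ext-× (suc n) (c ∷ r)))
            (≈-trans (×-congʳ (suc n) (≈-trans (ext-∼ r∼x) ext-x≈h)) hⁿ≈ε)) }
    where
      open FreeGroup X
      open Extension p₀ q₀ g

-- Hypermaps as Δ⁺-actions

module DartAction (p₀ q₀ m : ℕ) (α φ : Permutation′ (suc m))
                  (α-cycles : AllCyclesLength α (suc p₀)) (φ-cycles : AllCyclesLength φ (suc q₀)) where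
  open Δ (suc p₀) (suc q₀)
  open Δ-Group p₀ q₀

  perm : Gen → Permutation′ (suc m)
  perm a = α
  perm b = φ

  σ : Gen → Fin (suc m) → Fin (suc m)
  σ l i = perm l ⟨$⟩ʳ i

  act : Word → Fin (suc m) → Fin (suc m)
  act []      i = i
  act (l ∷ w) i = act w (σ l i)

  act-++ : ∀ u v i → act (u ++ v) i ≡ act v (act u i)
  act-++ []      v i = refl
  act-++ (l ∷ u) v i = act-++ u v (σ l i)

  act-replicate : ∀ l k i → act (replicate k l) i ≡ iter (perm l) k i
  act-replicate l zero    i = refl
  act-replicate l (suc k) i = trans (act-replicate l k (σ l i)) (iter-σ k)
    where
      iter-σ : ∀ k → iter (perm l) k (σ l i) ≡ σ l (iter (perm l) k i)
      iter-σ zero    = refl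
      iter-σ (suc k) = cong (σ l) (iter-σ k)

  act-relator : ∀ {w₁ w₂} → Rel w₁ w₂ → ∀ i → act w₁ i ≡ act w₂ i
  act-relator rel-a i = trans (act-replicate a (suc p₀) i) (proj₁ (α-cycles i))
  act-relator rel-b i = trans (act-replicate b (suc q₀) i) (proj₁ (φ-cycles i))

  act-≈ : ∀ {u v} → u ≈ v → ∀ i → act u i ≡ act v i
  act-≈ ≈-refl        i = refl
  act-≈ (≈-sym e)     i = sym (act-≈ e i)
  act-≈ (≈-trans e f) i = trans (act-≈ e i) (act-≈ f i)
  act-≈ (≈-rel u v {w₁} {w₂} r) i = begin
    act (u ++ w₁ ++ v) i      ≡⟨ trans (act-++ u (w₁ ++ v) i) (act-++ w₁ v (act u i)) ⟩
    act v (act w₁ (act u i))  ≡⟨ cong (act v) (act-relator r (act u i)) ⟩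
    act v (act w₂ (act u i))  ≡⟨ sym (trans (act-++ u (w₂ ++ v) i) (act-++ w₂ v (act u i))) ⟩
    act (u ++ w₂ ++ v) i      ∎
    where open ≡-Reasoning

  act-inv-act : ∀ w i → act (inv w) (act w i) ≡ i
  act-inv-act w i = trans (sym (act-++ w (inv w) i)) (act-≈ (inverseʳ w) i)

  act-act-inv : ∀ w i → act w (act (inv w) i) ≡ i
  act-act-inv w i = trans (sym (act-++ (inv w) w i)) (act-≈ (inverseˡ w) i)

  Stab : Word → Set
  Stab w = act w fzero ≡ fzero

  Stab-isSubgroup : IsSubgroup Stab
  Stab-isSubgroup = record
    { resp  = λ e s → trans (sym (act-≈ e fzero)) s
    ; one   = refl
    ; mul   = λ {u} {v} su sv → trans (act-++ u v fzero) (trans (cong (act v) su) sv)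
    ; inver = λ {u} su → trans (cong (act (inv u)) (sym su)) (act-inv-act u fzero) }

  act-fzero≡⇔Stab : ∀ u v → (act u fzero ≡ act v fzero) ⇔ Stab (u ++ inv v)
  act-fzero≡⇔Stab u v = mk⇔
    (λ e → trans (act-++ u (inv v) fzero) (trans (cong (act (inv v)) e) (act-inv-act v fzero)))
    (λ s → trans (sym (act-act-inv v (act u fzero)))
                 (cong (act v) (trans (sym (act-++ u (inv v) fzero)) s)))

  act-invGen : ∀ l i → act (invGen l) i ≡ perm l ⟨$⟩ˡ i
  act-invGen l i = trans (cong (act (invGen l)) (sym (inverseʳ′ (perm l))))
                         (act-≈ (invGen-inverseʳ l) (perm l ⟨$⟩ˡ i))

  reach⇒word : ∀ {i j} → Reach α φ i j → ∃ λ w → act w i ≡ j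
  reach⇒word here = [] , refl
  reach⇒word (stepα r) = let w , e = reach⇒word r in a ∷ w , e
  reach⇒word (stepφ r) = let w , e = reach⇒word r in b ∷ w , e
  reach⇒word {i} (stepα⁻ r) = let w , e = reach⇒word r in
    invGen a ++ w , trans (act-++ (invGen a) w i) (trans (cong (act w) (act-invGen a i)) e)
  reach⇒word {i} (stepφ⁻ r) = let w , e = reach⇒word r in
    invGen b ++ w , trans (act-++ (invGen b) w i) (trans (cong (act w) (act-invGen b i)) e)

  word⇒reach : ∀ w i → Reach α φ i (act w i)
  word⇒reach []      i = here
  word⇒reach (a ∷ w) i = stepα (word⇒reach w (σ a i))
  word⇒reach (b ∷ w) i = stepφ (word⇒reach w (σ b i))

  record SpanningTree : Set where
    field
      rank           : Fin (suc m) → ℕ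
      rank-injective : ∀ {i j} → rank i ≡ rank j → i ≡ j
      parent         : Fin (suc m) → Maybe (Fin (suc m) × Gen)
      parent-nothing : ∀ {j} → parent j ≡ nothing → j ≡ fzero
      parent-just    : ∀ {j i l} → parent j ≡ just (i , l) → rank i < rank j × σ l i ≡ j
      parent-root    : parent fzero ≡ nothing

module RootedIsomorphism (p₀ q₀ m : ℕ) where
  open Δ (suc p₀) (suc q₀)

  private
    Hypermap : Set
    Hypermap = PQHypermap (suc p₀) (suc q₀) m

    _≅_ : Hypermap → Hypermap → Set
    _≅_ = RootedIso (suc p₀) (suc q₀) (suc m)

  module Darts (H : Hypermap) = DartAction p₀ q₀ m (PQHypermap.α H) (PQHypermap.φ H)
                                           (PQHypermap.α-cycles H) (PQHypermap.φ-cycles H)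

  SameStab : Hypermap → Hypermap → Set
  SameStab H K = ∀ w → Darts.Stab H w ⇔ Darts.Stab K w

  ≅-act : ∀ H K → ((ψ , _) : H ≅ K) → ∀ w i → ψ ⟨$⟩ʳ Darts.act H w i ≡ Darts.act K w (ψ ⟨$⟩ʳ i)
  ≅-act H K I              []      i = refl
  ≅-act H K I@(_ , _ , ψα , _) (a ∷ w) i = trans (≅-act H K I w _) (cong (Darts.act K w) (ψα i))
  ≅-act H K I@(_ , _ , _ , ψφ) (b ∷ w) i = trans (≅-act H K I w _) (cong (Darts.act K w) (ψφ i))

  ≅⇒SameStab : ∀ H K → H ≅ K → SameStab H K
  ≅⇒SameStab H K I@(ψ , ψ0 , _) w = mk⇔
    (λ s → begin
      Darts.act K w fzero              ≡⟨ cong (Darts.act K w) ψ0 ⟨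
      Darts.act K w (ψ ⟨$⟩ʳ fzero)     ≡⟨ ≅-act H K I w fzero ⟨
      ψ ⟨$⟩ʳ Darts.act H w fzero       ≡⟨ cong (ψ ⟨$⟩ʳ_) s ⟩
      ψ ⟨$⟩ʳ fzero                     ≡⟨ ψ0 ⟩
      fzero                            ∎)
    (λ s → begin
      Darts.act H w fzero                        ≡⟨ inverseˡ′ ψ ⟨
      ψ ⟨$⟩ˡ (ψ ⟨$⟩ʳ Darts.act H w fzero)        ≡⟨ cong (ψ ⟨$⟩ˡ_) (≅-act H K I w fzero) ⟩
      ψ ⟨$⟩ˡ Darts.act K w (ψ ⟨$⟩ʳ fzero)        ≡⟨ cong (λ i → ψ ⟨$⟩ˡ Darts.act K w i) ψ0 ⟩
      ψ ⟨$⟩ˡ Darts.act K w fzero                 ≡⟨ cong (ψ ⟨$⟩ˡ_) (trans s (sym ψ0)) ⟩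
      ψ ⟨$⟩ˡ (ψ ⟨$⟩ʳ fzero)                      ≡⟨ inverseˡ′ ψ ⟩
      fzero                                      ∎)
    where open ≡-Reasoning

  -- The isomorphism sends the dart reached from the root by w in H to the one reached by w in K.
  SameStab⇒≅ : ∀ H K → SameStab H K → H ≅ K
  SameStab⇒≅ H K same = ψ , f-act [] , f-σ a , f-σ b
    where
      module H = Darts H
      module K = Darts K

      transfer : ∀ (H K : Hypermap) → SameStab H K → ∀ u v →
        Darts.act H u fzero ≡ Darts.act H v fzero → Darts.act K u fzero ≡ Darts.act K v fzero
      transfer H K same u v e = Equivalence.from (Darts.act-fzero≡⇔Stab K u v)
        (Equivalence.to (same (u ++ inv v)) (Equivalence.to (Darts.act-fzero≡⇔Stab H u v) e))

      same⁻¹ : SameStab K H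
      same⁻¹ w = mk⇔ (Equivalence.from (same w)) (Equivalence.to (same w))

      word : ∀ (H : Hypermap) i → ∃ λ w → Darts.act H w fzero ≡ i
      word H i = Darts.reach⇒word H (PQHypermap.connected H fzero i)

      f g : Fin (suc m) → Fin (suc m)
      f i = K.act (proj₁ (word H i)) fzero
      g i = H.act (proj₁ (word K i)) fzero

      f-act : ∀ u → f (H.act u fzero) ≡ K.act u fzero
      f-act u = transfer H K same (proj₁ (word H (H.act u fzero))) u (proj₂ (word H (H.act u fzero)))

      g-act : ∀ u → g (K.act u fzero) ≡ H.act u fzero
      g-act u = transfer K H same⁻¹ (proj₁ (word K (K.act u fzero))) u (proj₂ (word K (K.act u fzero)))

      ψ : Permutation′ (suc m)
      ψ = permutation f g
        (λ j → trans (f-act (proj₁ (word K j))) (proj₂ (word K j)))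
        (λ i → trans (g-act (proj₁ (word H i))) (proj₂ (word H i)))

      f-σ : ∀ l i → f (H.σ l i) ≡ K.σ l (f i)
      f-σ l i = begin
        f (H.σ l i)                      ≡⟨ cong (λ j → f (H.σ l j)) (proj₂ (word H i)) ⟨
        f (H.σ l (H.act w fzero))        ≡⟨ cong f (H.act-++ w [ l ] fzero) ⟨
        f (H.act (w ∷ʳ l) fzero)         ≡⟨ f-act (w ∷ʳ l) ⟩
        K.act (w ∷ʳ l) fzero             ≡⟨ K.act-++ w [ l ] fzero ⟩
        K.σ l (f i)                      ∎
        where
          w = proj₁ (word H i)
          open ≡-Reasoning

  ≅-refl : ∀ H → H ≅ H
  ≅-refl H = SameStab⇒≅ H H (λ w → mk⇔ (λ s → s) (λ s → s))

  ≅-sym : ∀ {H K} → H ≅ K → K ≅ H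
  ≅-sym {H} {K} I = SameStab⇒≅ K H λ w →
    mk⇔ (Equivalence.from (≅⇒SameStab H K I w)) (Equivalence.to (≅⇒SameStab H K I w))

  ≅-trans : ∀ {H K J} → H ≅ K → K ≅ J → H ≅ J
  ≅-trans {H} {K} {J} I₁ I₂ = SameStab⇒≅ H J λ w →
    Equiv.trans (≅⇒SameStab H K I₁ w) (≅⇒SameStab K J I₂ w)

module BreadthFirstSearch (p₀ q₀ m : ℕ) (α φ : Permutation′ (suc m))
                          (α-cycles : AllCyclesLength α (suc p₀)) (φ-cycles : AllCyclesLength φ (suc q₀)) where
  open Δ (suc p₀) (suc q₀)
  open Δ-Group p₀ q₀
  open DartAction p₀ q₀ m α φ α-cycles φ-cycles

  record PartialTree : Set where
    field
      next            : ℕ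
      label           : Fin (suc m) → Maybe ℕ
      label-root      : label fzero ≡ just 0
      label-<         : ∀ {j r} → label j ≡ just r → r < next
      label-injective : ∀ {j j′ r} → label j ≡ just r → label j′ ≡ just r → j ≡ j′
      label-parent    : ∀ {j r} → label j ≡ just r → j ≢ fzero →
                        ∃ λ i → ∃ λ l → ∃ λ r′ → label i ≡ just r′ × r′ < r × σ l i ≡ j

  open PartialTree

  Visited : PartialTree → Fin (suc m) → Set
  Visited t j = ∃ λ r → label t j ≡ just r

  Closed : PartialTree → Set
  Closed t = ∀ i l → Visited t i → Visited t (σ l i)

  unvisited : PartialTree → ℕ
  unvisited t = countTrue (λ j → is-nothing (label t j))

  root : PartialTree
  root = record { next = 1 ; label = label₀ ; label-root = refl
                ; label-< = <1 ; label-injective = injective ; label-parent = parent }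
    where
      label₀ : Fin (suc m) → Maybe ℕ
      label₀ fzero   = just 0
      label₀ (suc _) = nothing
      <1 : ∀ {j r} → label₀ j ≡ just r → r < 1
      <1 {fzero} refl = s≤s z≤n
      injective : ∀ {j j′ r} → label₀ j ≡ just r → label₀ j′ ≡ just r → j ≡ j′
      injective {fzero} {fzero} _ _ = refl
      parent : ∀ {j r} → label₀ j ≡ just r → j ≢ fzero → _
      parent {fzero} _ j≢0 = ⊥-elim (j≢0 refl)

  module Extend (t : PartialTree) (i : Fin (suc m)) (l : Gen) {r : ℕ}
                (i↦r : label t i ≡ just r) (new↦nothing : label t (σ l i) ≡ nothing) where

    new : Fin (suc m)
    new = σ l i

    label′ : Fin (suc m) → Maybe ℕ
    label′ j with j ≟ new
    ... | yes _ = just (next t)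
    ... | no  _ = label t j

    view : ∀ j → (j ≡ new × label′ j ≡ just (next t)) ⊎ (j ≢ new × label′ j ≡ label t j)
    view j with j ≟ new
    ... | yes e = inj₁ (e , refl)
    ... | no ne = inj₂ (ne , refl)

    label′-old : ∀ {j r} → label t j ≡ just r → label′ j ≡ just r
    label′-old {j} e with view j
    ... | inj₁ (refl , _) with trans (sym e) new↦nothing
    ...   | ()
    label′-old {j} e | inj₂ (_ , e′) = trans e′ e

    label′-< : ∀ {j r} → label′ j ≡ just r → r < suc (next t)
    label′-< {j} e with view j
    ... | inj₁ (_ , e′) with trans (sym e) e′
    ...   | refl = n<1+n _
    label′-< {j} e | inj₂ (_ , e′) = m<n⇒m<1+n (label-< t (trans (sym e′) e))

    label′-injective : ∀ {j j′ r} → label′ j ≡ just r → label′ j′ ≡ just r → j ≡ j′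
    label′-injective {j} {j′} e₁ e₂ with view j | view j′
    ... | inj₁ (refl , _) | inj₁ (refl , _) = refl
    ... | inj₁ (_ , x)    | inj₂ (_ , y) with trans (sym e₁) x
    ...   | refl = ⊥-elim (<-irrefl refl (label-< t (trans (sym y) e₂)))
    label′-injective e₁ e₂ | inj₂ (_ , x) | inj₁ (_ , y) with trans (sym e₂) y
    ...   | refl = ⊥-elim (<-irrefl refl (label-< t (trans (sym x) e₁)))
    label′-injective e₁ e₂ | inj₂ (_ , x) | inj₂ (_ , y) = label-injective t (trans (sym x) e₁) (trans (sym y) e₂)

    label′-parent : ∀ {j r} → label′ j ≡ just r → j ≢ fzero →
                    ∃ λ i′ → ∃ λ l′ → ∃ λ r′ → label′ i′ ≡ just r′ × r′ < r × σ l′ i′ ≡ j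
    label′-parent {j} e j≢0 with view j
    ... | inj₁ (refl , x) with trans (sym e) x
    ...   | refl = i , l , r , label′-old i↦r , label-< t i↦r , refl
    label′-parent {j} e j≢0 | inj₂ (_ , x) =
      let i′ , l′ , r′ , e′ , lt , σ≡ = label-parent t (trans (sym x) e) j≢0
      in  i′ , l′ , r′ , label′-old e′ , lt , σ≡

    extended : PartialTree
    extended = record
      { next = suc (next t) ; label = label′ ; label-root = label′-old {fzero} (label-root t)
      ; label-< = λ {j} → label′-< {j} ; label-injective = λ {j} {j′} → label′-injective {j} {j′}
      ; label-parent = λ {j} → label′-parent {j} }

    unvisited-< : unvisited extended < unvisited t
    unvisited-< = countTrue-< _ _ still-unvisited new (subst (T ∘ is-nothing) (sym new↦nothing) _) new-visited
      where
        new-visited : ¬ T (is-nothing (label′ new))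
        new-visited with view new
        ... | inj₁ (_ , e)  = subst (λ x → ¬ T (is-nothing x)) (sym e) λ ()
        ... | inj₂ (ne , _) = ⊥-elim (ne refl)
        still-unvisited : ∀ j → T (is-nothing (label′ j)) → T (is-nothing (label t j))
        still-unvisited j u with view j
        ... | inj₁ (_ , e) = ⊥-elim (subst (T ∘ is-nothing) e u)
        ... | inj₂ (_ , e) = subst (T ∘ is-nothing) e u

  extend : (t : PartialTree) (i : Fin (suc m)) (l : Gen) {r : ℕ} → label t i ≡ just r →
           label t (σ l i) ≡ nothing → Σ PartialTree λ t′ → unvisited t′ < unvisited t
  extend t i l i↦r new↦nothing = extended , unvisited-<
    where open Extend t i l i↦r new↦nothing

  step : (t : PartialTree) → Closed t ⊎ (Σ PartialTree λ t′ → unvisited t′ < unvisited t)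
  step t with any? (λ i → frontier? i a ⊎-dec frontier? i b)
    where
      frontier? : ∀ i l → Dec (∃ λ r → label t i ≡ just r × label t (σ l i) ≡ nothing)
      frontier? i l with label t i | label t (σ l i)
      ... | just r  | nothing = yes (r , refl , refl)
      ... | just _  | just _  = no λ { (_ , _ , ()) }
      ... | nothing | _       = no λ { (_ , () , _) }
  ... | yes (i , inj₁ (_ , e₁ , e₂)) = inj₂ (extend t i a e₁ e₂)
  ... | yes (i , inj₂ (_ , e₁ , e₂)) = inj₂ (extend t i b e₁ e₂)
  ... | no  none = inj₁ closed
    where
      closed : Closed t
      closed i l (r , e) with label t (σ l i) in e′
      ... | just r′ = r′ , refl
      closed i a (r , e) | nothing = ⊥-elim (none (i , inj₁ (r , e , e′)))
      closed i b (r , e) | nothing = ⊥-elim (none (i , inj₂ (r , e , e′)))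

  closedTree : Σ PartialTree Closed
  closedTree = go (unvisited root) root ≤-refl
    where
      go : ∀ n (t : PartialTree) → unvisited t ≤ n → Σ PartialTree Closed
      go n t u≤n with step t
      ... | inj₁ closed = t , closed
      go (suc n) t u≤n | inj₂ (t′ , lt) = go n t′ (≤-pred (≤-trans lt u≤n))
      go zero    t u≤n | inj₂ (t′ , lt) = ⊥-elim (n≮0 (≤-trans lt u≤n))

  private
    tree = proj₁ closedTree

  visited-act : ∀ w i → Visited tree i → Visited tree (act w i)
  visited-act []      i v = v
  visited-act (l ∷ w) i v = visited-act w (σ l i) (proj₂ closedTree i l v)

  word-to : ∀ n j r → label tree j ≡ just r → r < n → ∃ λ w → act w fzero ≡ j
  word-to (suc n) j r e r<n with j ≟ fzero
  ... | yes refl = [] , refl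
  ... | no  j≢0  =
    let i , l , r′ , e′ , r′<r , σ≡ = label-parent tree e j≢0
        w , act≡ = word-to n i r′ e′ (<-≤-trans r′<r (≤-pred r<n))
    in w ∷ʳ l , trans (act-++ w [ l ] fzero) (trans (cong (σ l) act≡) σ≡)

  allVisited⇒transitive : (∀ j → Visited tree j) → Transitive α φ
  allVisited⇒transitive visited i j = subst (Reach α φ i) path (word⇒reach (inv wᵢ ++ wⱼ) i)
    where
      word : ∀ j → ∃ λ w → act w fzero ≡ j
      word j = let r , e = visited j in word-to (suc r) j r e ≤-refl
      wᵢ = proj₁ (word i)
      wⱼ = proj₁ (word j)
      path : act (inv wᵢ ++ wⱼ) i ≡ j
      path = trans (act-++ (inv wᵢ) wⱼ i) (trans (cong (λ x → act wⱼ (act (inv wᵢ) x)) (sym (proj₂ (word i))))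
               (trans (cong (act wⱼ) (act-inv-act wᵢ fzero)) (proj₂ (word j))))

  transitive⇒allVisited : Transitive α φ → ∀ j → Visited tree j
  transitive⇒allVisited trans j = let w , e = reach⇒word (trans fzero j) in
    subst (Visited tree) e (visited-act w fzero (0 , label-root tree))

  transitive? : Dec (Transitive α φ)
  transitive? = map′ allVisited⇒transitive transitive⇒allVisited (all? visited?)
    where
      visited? : ∀ j → Dec (Visited tree j)
      visited? j with label tree j
      ... | just r  = yes (r , refl)
      ... | nothing = no λ ()

  spanningTree : Transitive α φ → SpanningTree
  spanningTree transitive = record
    { rank = rank ; rank-injective = rank-injective ; parent = parent
    ; parent-nothing = parent-nothing ; parent-just = parent-just ; parent-root = parent-root }
    where
      visited = transitive⇒allVisited transitive
      rank : Fin (suc m) → ℕ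
      rank j = proj₁ (visited j)
      rank-injective : ∀ {i j} → rank i ≡ rank j → i ≡ j
      rank-injective {i} {j} e =
        label-injective tree (proj₂ (visited i)) (subst (λ r → label tree j ≡ just r) (sym e) (proj₂ (visited j)))
      parent : Fin (suc m) → Maybe (Fin (suc m) × Gen)
      parent j with j ≟ fzero
      ... | yes _   = nothing
      ... | no  j≢0 = let i , l , _ = label-parent tree (proj₂ (visited j)) j≢0 in just (i , l)
      parent-nothing : ∀ {j} → parent j ≡ nothing → j ≡ fzero
      parent-nothing {j} e with j ≟ fzero
      ... | yes j≡0 = j≡0
      parent-just : ∀ {j i l} → parent j ≡ just (i , l) → rank i < rank j × σ l i ≡ j
      parent-just {j} e with j ≟ fzero
      ... | no j≢0 with label-parent tree (proj₂ (visited j)) j≢0 | e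
      ...   | i , l , r′ , e′ , lt , σ≡ | refl =
        subst (_< rank j) (just-injective (trans (sym e′) (proj₂ (visited i)))) lt , σ≡
      parent-root : parent fzero ≡ nothing
      parent-root with fzero {n = m} ≟ fzero
      ... | yes _ = refl
      ... | no ne = ⊥-elim (ne refl)

-- Free subgroups give hypermaps

module CosetHypermap (p₀ q₀ m : ℕ) (S : Δ.FreeSubgroupOfIndex (suc p₀) (suc q₀) (suc m)) where
  open Δ (suc p₀) (suc q₀)
  open Δ-Group p₀ q₀
  open GeneratorOrders p₀ q₀

  H : Word → Set
  H = proj₁ S

  open IsSubgroup (proj₁ (proj₂ S))

  private
    index : Word → Fin (suc m)
    index = proj₁ (proj₁ (proj₂ (proj₂ S)))

    index-onto : ∀ j → ∃ λ u → index u ≡ j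
    index-onto = proj₁ (proj₂ (proj₁ (proj₂ (proj₂ S))))

    index≡⇔H : ∀ u v → (index u ≡ index v) ⇔ H (u ++ inv v)
    index≡⇔H = proj₂ (proj₂ (proj₁ (proj₂ (proj₂ S))))

    H-free : IsFree H
    H-free = proj₂ (proj₂ (proj₂ S))

    -- relabel the cosets so that H itself is the root
    τ : Permutation′ (suc m)
    τ = transpose (index []) fzero

  coset : Word → Fin (suc m)
  coset u = τ ⟨$⟩ʳ index u

  coset-onto : ∀ i → ∃ λ u → coset u ≡ i
  coset-onto i = let u , e = index-onto (τ ⟨$⟩ˡ i) in
    u , trans (cong (τ ⟨$⟩ʳ_) e) (inverseʳ′ τ)

  coset≡⇔H : ∀ u v → (coset u ≡ coset v) ⇔ H (u ++ inv v)
  coset≡⇔H u v = Equiv.trans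
    (mk⇔ (λ e → trans (sym (inverseˡ′ τ)) (trans (cong (τ ⟨$⟩ˡ_) e) (inverseˡ′ τ))) (cong (τ ⟨$⟩ʳ_)))
    (index≡⇔H u v)

  coset-[] : coset [] ≡ fzero
  coset-[] rewrite dec-true (index [] ≟ index []) refl = refl

  coset-≈ : ∀ {u v} → u ≈ v → coset u ≡ coset v
  coset-≈ {u} {v} e = Equivalence.from (coset≡⇔H u v) (resp (≈-sym (≈-trans (≈-congʳ (inv v) e) (inverseʳ v))) one)

  coset-++ʳ : ∀ u v w → coset u ≡ coset v → coset (u ++ w) ≡ coset (v ++ w)
  coset-++ʳ u v w e = Equivalence.from (coset≡⇔H (u ++ w) (v ++ w))
    (resp (≈-sym (≈-trans (≡⇒≈ reassoc) (≈-congʳ (inv v) (cancelʳ u w)))) (Equivalence.to (coset≡⇔H u v) e))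
    where
      reassoc : (u ++ w) ++ inv (v ++ w) ≡ ((u ++ w) ++ inv w) ++ inv v
      reassoc = trans (cong ((u ++ w) ++_) (inv-++ v w)) (sym (++-assoc (u ++ w) (inv w) (inv v)))
      cancelʳ : ∀ u w → ((u ++ w) ++ inv w) ≈ u
      cancelʳ u w = //-rightDividesʳ w u
        where open GroupProperties Δ-group using (//-rightDividesʳ)

  representative : Fin (suc m) → Word
  representative i = proj₁ (coset-onto i)

  coset-representative : ∀ i → coset (representative i) ≡ i
  coset-representative i = proj₂ (coset-onto i)

  -- H u ↦ H u l is well defined, so it is read off any representative.
  right : Gen → Fin (suc m) → Fin (suc m)
  right l i = coset (representative i ++ [ l ])

  right-coset : ∀ l u → right l (coset u) ≡ coset (u ∷ʳ l)
  right-coset l u = coset-++ʳ (representative (coset u)) u [ l ] (coset-representative (coset u))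

  right⁻¹ : Gen → Fin (suc m) → Fin (suc m)
  right⁻¹ l i = coset (representative i ++ invGen l)

  right⁻¹-coset : ∀ l u → right⁻¹ l (coset u) ≡ coset (u ++ invGen l)
  right⁻¹-coset l u = coset-++ʳ (representative (coset u)) u (invGen l) (coset-representative (coset u))

  generatorPerm : Gen → Permutation′ (suc m)
  generatorPerm l = permutation (right l) (right⁻¹ l)
    (λ i → trans (right-coset l (representative i ++ invGen l))
      (trans (coset-≈ (≈-trans (≡⇒≈ (++-assoc (representative i) (invGen l) [ l ]))
               (≈-trans (≈-congˡ (representative i) (invGen-inverseˡ l)) (≡⇒≈ (++-identityʳ _)))))
             (coset-representative i)))
    (λ i → trans (right⁻¹-coset l (representative i ++ [ l ]))
      (trans (coset-≈ (≈-trans (≡⇒≈ (++-assoc (representative i) [ l ] (invGen l)))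
               (≈-trans (≈-congˡ (representative i) (invGen-inverseʳ l)) (≡⇒≈ (++-identityʳ _)))))
             (coset-representative i)))

  iter-coset : ∀ l k u → iter (generatorPerm l) k (coset u) ≡ coset (u ++ replicate k l)
  iter-coset l zero    u = cong coset (sym (++-identityʳ u))
  iter-coset l (suc k) u = trans (cong (right l) (iter-coset l k u)) (trans (right-coset l (u ++ replicate k l))
    (cong coset (trans (++-assoc u (replicate k l) [ l ]) (cong (u ++_) (replicate-∷ʳ k l)))))

  -- A fixed coset H u of lᵏ puts the conjugate u lᵏ u⁻¹ into H; it has finite order,
  -- so it is trivial because free groups are torsion-free, contradicting 0 < k < order l.
  generatorPerm-noFix : ∀ l k → 0 < k → k < order l → ∀ i → iter (generatorPerm l) k i ≢ i
  generatorPerm-noFix l k 0<k k<o i fixed =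
    FreeSubgroups.IsFree⇒¬¬torsionFree p₀ q₀ H-free u·lᵏ·u⁻¹∈H (order₀ l) hᵒ≈ε
      λ h≈ε → replicate≉[] l k 0<k k<o (conj≈ε⇒≈ε u lᵏ h≈ε)
    where
      open Conjugation Δ-group using (×-conj; conj≈ε⇒≈ε)
      u = representative i
      lᵏ = replicate k l
      u·lᵏ·u⁻¹∈H : H ((u ++ lᵏ) ++ inv u)
      u·lᵏ·u⁻¹∈H = Equivalence.to (coset≡⇔H (u ++ lᵏ) u)
        (trans (sym (iter-coset l k u)) (trans (cong (iter (generatorPerm l) k) (coset-representative i))
          (trans fixed (sym (coset-representative i)))))
      hᵒ≈ε : (order l ×ᵂ ((u ++ lᵏ) ++ inv u)) ≈ []
      hᵒ≈ε = ≈-trans (×-conj (order l) u lᵏ)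
        (≈-trans (≈-congʳ (inv u) (≈-congˡ u (≈-trans (≡⇒≈ (×ᵂ-replicate (order l) k l))
          (≈-trans (≡⇒≈ (cong (λ n → replicate n l) (*-comm (order l) k))) (relator-multiple l k)))))
          (≈-trans (≡⇒≈ (cong (_++ inv u) (++-identityʳ u))) (inverseʳ u)))

  generatorPerm-cycles : ∀ l → AllCyclesLength (generatorPerm l) (order l)
  generatorPerm-cycles l i =
    trans (cong (iter (generatorPerm l) (order l)) (sym (coset-representative i)))
      (trans (iter-coset l (order l) (representative i))
        (trans (coset-≈ (≈-trans (≈-congˡ (representative i) (relator⇒≈ (relator l))) (≡⇒≈ (++-identityʳ _))))
          (coset-representative i)))
    , λ k 0<k k<o → generatorPerm-noFix l k 0<k k<o i

  private
    Reach′ = Reach (generatorPerm a) (generatorPerm b)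

    reach-++ : ∀ u w → Reach′ (coset u) (coset (u ++ w))
    reach-++ u []      = subst (λ z → Reach′ (coset u) (coset z)) (sym (++-identityʳ u)) here
    reach-++ u (a ∷ w) = stepα (subst₂ Reach′ (sym (right-coset a u)) (cong coset (++-assoc u [ a ] w))
                                        (reach-++ (u ∷ʳ a) w))
    reach-++ u (b ∷ w) = stepφ (subst₂ Reach′ (sym (right-coset b u)) (cong coset (++-assoc u [ b ] w))
                                        (reach-++ (u ∷ʳ b) w))

  cosetHypermap-connected : Transitive (generatorPerm a) (generatorPerm b)
  cosetHypermap-connected i j = subst₂ Reach′ (coset-representative i)
    (trans (coset-≈ (≈-trans (≡⇒≈ (sym (++-assoc u (inv u) (representative j))))
                       (≈-congʳ (representative j) (inverseʳ u))))
           (coset-representative j))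
    (reach-++ u (inv u ++ representative j))
    where u = representative i

  cosetHypermap : PQHypermap (suc p₀) (suc q₀) m
  cosetHypermap = record
    { α = generatorPerm a ; φ = generatorPerm b ; connected = cosetHypermap-connected
    ; α-cycles = generatorPerm-cycles a ; φ-cycles = generatorPerm-cycles b }

  open DartAction p₀ q₀ m (generatorPerm a) (generatorPerm b) (generatorPerm-cycles a) (generatorPerm-cycles b)

  act-coset : ∀ w u → act w (coset u) ≡ coset (u ++ w)
  act-coset []      u = cong coset (sym (++-identityʳ u))
  act-coset (l ∷ w) u = trans (cong (act w) (σ-coset l)) (trans (act-coset w (u ∷ʳ l)) (cong coset (++-assoc u [ l ] w)))
    where
      σ-coset : ∀ l → σ l (coset u) ≡ coset (u ∷ʳ l)
      σ-coset a = right-coset a u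
      σ-coset b = right-coset b u

  Stab⇔H : ∀ w → Stab w ⇔ H w
  Stab⇔H w = Equiv.trans (mk⇔ to from) (Equiv.trans (coset≡⇔H w [])
    (mk⇔ (resp (≡⇒≈ (++-identityʳ w))) (resp (≡⇒≈ (sym (++-identityʳ w))))))
    where
      to : Stab w → coset w ≡ coset []
      to s = trans (sym (act-coset w [])) (trans (cong (act w) coset-[]) (trans s (sym coset-[])))
      from : coset w ≡ coset [] → Stab w
      from e = trans (cong (act w) (sym coset-[])) (trans (act-coset w []) (trans e coset-[]))

-- Reidemeister–Schreier: root stabilisers are free

module Schreier (p₀ q₀ m : ℕ) (M : PQHypermap (suc p₀) (suc q₀) m) where
  open Δ (suc p₀) (suc q₀)
  open Δ-Group p₀ q₀
  open GeneratorOrders p₀ q₀ using (order; order₀; relator; relator-multiple; _≟ᴳ_)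
  open PQHypermap M
  open DartAction p₀ q₀ m α φ α-cycles φ-cycles

  walk : Gen → ℕ → Fin (suc m) → Fin (suc m)
  walk l k i = act (replicate k l) i

  walk-+ : ∀ l j k i → walk l (j + k) i ≡ walk l k (walk l j i)
  walk-+ l j k i = trans (cong (λ w → act w i) (replicate-+ j k l)) (act-++ (replicate j l) (replicate k l) i)

  walk-suc : ∀ l k i → walk l (suc k) i ≡ σ l (walk l k i)
  walk-suc l k i = trans (cong (λ w → act w i) (sym (replicate-∷ʳ k l))) (act-++ (replicate k l) [ l ] i)

  walk-order₀-σ : ∀ l i → walk l (order₀ l) (σ l i) ≡ i
  walk-order₀-σ l i = act-relator (relator l) i

  σ-walk-order₀ : ∀ l i → σ l (walk l (order₀ l) i) ≡ i
  σ-walk-order₀ l i = trans (sym (walk-suc l (order₀ l) i)) (act-relator (relator l) i)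

  walk-% : ∀ l k i → walk l k i ≡ walk l (k % order l) i
  walk-% l k i = begin
    walk l k i                                       ≡⟨ cong (λ n → walk l n i) (m≡m%n+[m/n]*n k (order l)) ⟩
    walk l (k % order l + k / order l * order l) i   ≡⟨ walk-+ l (k % order l) _ i ⟩
    walk l (k / order l * order l) (walk l (k % order l) i)
                                                     ≡⟨ act-≈ (relator-multiple l (k / order l)) _ ⟩
    walk l (k % order l) i                           ∎
    where open ≡-Reasoning

  walk-noFix : ∀ l k → 0 < k → k < order l → ∀ i → walk l k i ≢ i
  walk-noFix l k 0<k k<o i e = proj₂ (cycles l i) k 0<k k<o (trans (sym (act-replicate l k i)) e)
    where
      cycles : ∀ l → AllCyclesLength (perm l) (order l)
      cycles a = α-cycles
      cycles b = φ-cycles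

  module _ (spanningTree : SpanningTree) where
    open SpanningTree spanningTree

    opaque
      orbit : Gen → Fin (suc m) → List (Fin (suc m))
      orbit l i = applyUpTo (λ k → walk l k i) (order l)

      cycleMin : Gen → Fin (suc m) → Fin (suc m)
      cycleMin l i = argmin rank i (orbit l i)

      cycleMin-minimal : ∀ l k i → rank (cycleMin l i) ≤ rank (walk l k i)
      cycleMin-minimal l k i = subst (λ j → rank (cycleMin l i) ≤ rank j) (sym (walk-% l k i))
        (All.lookup (f[argmin]≤f[xs] {f = rank} i (orbit l i)) (∈-applyUpTo⁺ (λ k → walk l k i) (m%n<n k (order l))))

      cycleMin-∈ : ∀ l i → ∃ λ k → walk l k i ≡ cycleMin l i
      cycleMin-∈ l i with argmin-sel rank i (orbit l i)
      ... | inj₁ e = 0 , sym e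
      ... | inj₂ e∈ = let k , _ , e = ∈-applyUpTo⁻ (λ k → walk l k i) e∈ in k , sym e

    cycleMin-σ : ∀ l i → cycleMin l (σ l i) ≡ cycleMin l i
    cycleMin-σ l i = rank-injective (≤-antisym (via (order₀ l + k₁) (σ l i) (trans (walk-+ l (order₀ l) k₁ (σ l i))
                                                  (trans (cong (walk l k₁) (walk-order₀-σ l i)) e₁)))
                                               (via (1 + k₂) i (trans (walk-+ l 1 k₂ i) e₂)))
      where
        k₁ = proj₁ (cycleMin-∈ l i)
        e₁ = proj₂ (cycleMin-∈ l i)
        k₂ = proj₁ (cycleMin-∈ l (σ l i))
        e₂ = proj₂ (cycleMin-∈ l (σ l i))
        via : ∀ k j {x} → walk l k j ≡ x → rank (cycleMin l j) ≤ rank x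
        via k j e = subst (λ x → rank (cycleMin l j) ≤ rank x) e (cycleMin-minimal l k j)

    cycleMin-walk : ∀ l k i → cycleMin l (walk l k i) ≡ cycleMin l i
    cycleMin-walk l zero    i = refl
    cycleMin-walk l (suc k) i = trans (cong (cycleMin l) (walk-suc l k i))
                                      (trans (cycleMin-σ l (walk l k i)) (cycleMin-walk l k i))

    cycleMin-idem : ∀ l i → cycleMin l (cycleMin l i) ≡ cycleMin l i
    cycleMin-idem l i = let k , e = cycleMin-∈ l i in trans (cong (cycleMin l) (sym e)) (cycleMin-walk l k i)

    isTreeEdge : Fin (suc m) → Gen → Bool
    isTreeEdge i l = ⌊ Maybe.≡-dec (≡-dec _≟_ _≟ᴳ_) (parent (σ l i)) (just (i , l)) ⌋

    -- the edge entering the rank-minimal dart of an l-cycle; the relator lᵒʳᵈᵉʳ eliminates it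
    isClosingEdge : Fin (suc m) → Gen → Bool
    isClosingEdge i l = ⌊ σ l i ≟ cycleMin l (σ l i) ⌋

    isFreeEdge : Fin (suc m) → Gen → Bool
    isFreeEdge i l = not (isTreeEdge i l ∨ isClosingEdge i l)

    treeEdge⇒parent : ∀ {i l} → T (isTreeEdge i l) → parent (σ l i) ≡ just (i , l)
    treeEdge⇒parent {i} {l} = toWitness {a? = Maybe.≡-dec (≡-dec _≟_ _≟ᴳ_) (parent (σ l i)) (just (i , l))}

    parent⇒treeEdge : ∀ {i l} → parent (σ l i) ≡ just (i , l) → T (isTreeEdge i l)
    parent⇒treeEdge {i} {l} = fromWitness {a? = Maybe.≡-dec (≡-dec _≟_ _≟ᴳ_) (parent (σ l i)) (just (i , l))}

    treeEdge⇒¬closing : ∀ {i l} → T (isTreeEdge i l) → ¬ T (isClosingEdge i l)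
    treeEdge⇒¬closing {i} {l} tree closing = <-irrefl refl (<-≤-trans (proj₁ (parent-just (treeEdge⇒parent tree)))
      (subst (λ j → rank j ≤ rank i) (sym (toWitness {a? = σ l i ≟ cycleMin l (σ l i)} closing))
        (subst (λ j → rank (cycleMin l (σ l i)) ≤ rank j) (walk-order₀-σ l i)
               (cycleMin-minimal l (order₀ l) (σ l i)))))

    FreeEdge : Set
    FreeEdge = Σ (Fin (suc m) × Gen) λ (i , l) → T (isFreeEdge i l)

    _≟ᴱ_ : DecidableEquality FreeEdge
    _≟ᴱ_ = ≡-dec (≡-dec _≟_ _≟ᴳ_) λ x y → yes (T-irrelevant x y)

    open FreeGroup FreeEdge

    edgeLetter : Fin (suc m) → Gen → FreeWord
    edgeLetter i l with T? (isFreeEdge i l)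
    ... | yes t = [ ((i , l) , t) , true ]
    ... | no  _ = []

    edgeLetter-free : ∀ i l (t : T (isFreeEdge i l)) → edgeLetter i l ≡ [ ((i , l) , t) , true ]
    edgeLetter-free i l t with T? (isFreeEdge i l)
    ... | yes t′ = cong (λ t → [ ((i , l) , t) , true ]) (T-irrelevant t′ t)
    ... | no  nt = ⊥-elim (nt t)

    edgeLetter-notFree : ∀ i l → ¬ T (isFreeEdge i l) → edgeLetter i l ≡ []
    edgeLetter-notFree i l nt with T? (isFreeEdge i l)
    ... | yes t = ⊥-elim (nt t)
    ... | no  _ = refl

    cyclePath : Gen → Fin (suc m) → ℕ → FreeWord
    cyclePath l x zero    = []
    cyclePath l x (suc k) = edgeLetter x l ++ cyclePath l (σ l x) k

    letterImage : Fin (suc m) → Gen → FreeWord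
    letterImage i l with T? (isClosingEdge i l)
    ... | yes _ = invᶠ (cyclePath l (σ l i) (order₀ l))
    ... | no  _ = edgeLetter i l

    letterImage-closing : ∀ {i l} → T (isClosingEdge i l) → letterImage i l ≡ invᶠ (cyclePath l (σ l i) (order₀ l))
    letterImage-closing {i} {l} t with T? (isClosingEdge i l)
    ... | yes _  = refl
    ... | no  nt = ⊥-elim (nt t)

    letterImage-notClosing : ∀ {i l} → ¬ T (isClosingEdge i l) → letterImage i l ≡ edgeLetter i l
    letterImage-notClosing {i} {l} nt with T? (isClosingEdge i l)
    ... | yes t = ⊥-elim (nt t)
    ... | no  _ = refl

    rewriteWord : Word → Fin (suc m) → FreeWord
    rewriteWord []      i = []
    rewriteWord (l ∷ w) i = letterImage i l ++ rewriteWord w (σ l i)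

    rewriteWord-++ : ∀ u v i → rewriteWord (u ++ v) i ≡ rewriteWord u i ++ rewriteWord v (act u i)
    rewriteWord-++ []      v i = refl
    rewriteWord-++ (l ∷ u) v i = trans (cong (letterImage i l ++_) (rewriteWord-++ u v (σ l i)))
                                       (sym (++-assoc (letterImage i l) (rewriteWord u (σ l i)) _))

    private
      open GroupProperties freeGroup using (∙-cancelˡ)

      relatorWord : Gen → Word
      relatorWord l = replicate (order l) l

      noClosingEdge-before-min : ∀ l r → cycleMin l r ≡ r → ∀ k → k < order₀ l → ¬ T (isClosingEdge (walk l k r) l)
      noClosingEdge-before-min l r min≡r k k<o closing = walk-noFix l (suc k) (s≤s z≤n) (s≤s k<o) r (begin
        walk l (suc k) r                     ≡⟨ walk-suc l k r ⟩
        σ l (walk l k r)                     ≡⟨ toWitness {a? = σ l (walk l k r) ≟ cycleMin l (σ l (walk l k r))} closing ⟩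
        cycleMin l (σ l (walk l k r))        ≡⟨ cong (cycleMin l) (walk-suc l k r) ⟨
        cycleMin l (walk l (suc k) r)        ≡⟨ cycleMin-walk l (suc k) r ⟩
        cycleMin l r                         ≡⟨ min≡r ⟩
        r                                    ∎)
        where open ≡-Reasoning

      rewriteWord-replicate : ∀ l k x → (∀ j → j < k → ¬ T (isClosingEdge (walk l j x) l)) →
                              rewriteWord (replicate k l) x ≡ cyclePath l x k
      rewriteWord-replicate l zero    x _    = refl
      rewriteWord-replicate l (suc k) x notClosing = cong₂ _++_ (letterImage-notClosing (notClosing 0 (s≤s z≤n)))
        (rewriteWord-replicate l k (σ l x) (λ j j<k → notClosing (suc j) (s≤s j<k)))

      rewriteWord-relator-atMin : ∀ l r → cycleMin l r ≡ r → rewriteWord (relatorWord l) r ∼ []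
      rewriteWord-relator-atMin l r min≡r = ∼-trans (≡⇒∼ path++inv) (invᶠ-inverseʳ C)
        where
          C = cyclePath l r (order₀ l)
          j = walk l (order₀ l) r
          closing : T (isClosingEdge j l)
          closing = fromWitness (trans (σ-walk-order₀ l r) (sym (trans (cong (cycleMin l) (σ-walk-order₀ l r)) min≡r)))
          path++inv : rewriteWord (relatorWord l) r ≡ C ++ invᶠ C
          path++inv = begin
            rewriteWord (relatorWord l) r                           ≡⟨ cong (λ w → rewriteWord w r) (sym (replicate-∷ʳ (order₀ l) l)) ⟩
            rewriteWord (replicate (order₀ l) l ∷ʳ l) r             ≡⟨ rewriteWord-++ (replicate (order₀ l) l) [ l ] r ⟩
            rewriteWord (replicate (order₀ l) l) r ++ (letterImage j l ++ [])
                               ≡⟨ cong₂ _++_ (rewriteWord-replicate l (order₀ l) r (noClosingEdge-before-min l r min≡r))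
                                             (trans (++-identityʳ _) (letterImage-closing closing)) ⟩
            C ++ invᶠ (cyclePath l (σ l j) (order₀ l))              ≡⟨ cong (λ x → C ++ invᶠ (cyclePath l x (order₀ l))) (σ-walk-order₀ l r) ⟩
            C ++ invᶠ C                                             ∎
            where open ≡-Reasoning

      -- l · lᵒʳᵈᵉʳ = lᵒʳᵈᵉʳ · l, and both rewritings start resp. end with the letter of the edge (j, l).
      rewriteWord-relator-σ : ∀ l j → rewriteWord (relatorWord l) j ∼ [] → rewriteWord (relatorWord l) (σ l j) ∼ []
      rewriteWord-relator-σ l j R≈ε =
        ∙-cancelˡ (letterImage j l) _ [] (∼-trans (≡⇒∼ rotate) (∼-congʳ (letterImage j l ++ []) R≈ε))
        where
          rotate : rewriteWord (l ∷ relatorWord l) j ≡ rewriteWord (relatorWord l) j ++ (letterImage j l ++ [])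
          rotate = trans (cong (λ w → rewriteWord w j) (sym (replicate-∷ʳ (order l) l)))
            (trans (rewriteWord-++ (relatorWord l) [ l ] j)
                   (cong (λ x → rewriteWord (relatorWord l) j ++ (letterImage x l ++ [])) (act-relator (relator l) j)))

    rewriteWord-relator : ∀ l j → rewriteWord (replicate (order l) l) j ∼ []
    rewriteWord-relator l j = subst (λ x → rewriteWord (relatorWord l) x ∼ []) walk-back (fromMin (order l ∸ k′))
      where
        r = cycleMin l j
        fromMin : ∀ k → rewriteWord (relatorWord l) (walk l k r) ∼ []
        fromMin zero    = rewriteWord-relator-atMin l r (cycleMin-idem l j)
        fromMin (suc k) = subst (λ x → rewriteWord (relatorWord l) x ∼ []) (sym (walk-suc l k r))
                                (rewriteWord-relator-σ l _ (fromMin k))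
        k  = proj₁ (cycleMin-∈ l j)
        k′ = k % order l
        walk-back : walk l (order l ∸ k′) r ≡ j
        walk-back = begin
          walk l (order l ∸ k′) r                  ≡⟨ cong (walk l (order l ∸ k′))
                                                          (sym (trans (sym (walk-% l k j)) (proj₂ (cycleMin-∈ l j)))) ⟩
          walk l (order l ∸ k′) (walk l k′ j)      ≡⟨ walk-+ l k′ (order l ∸ k′) j ⟨
          walk l (k′ + (order l ∸ k′)) j           ≡⟨ cong (λ n → walk l n j) (m+[n∸m]≡n (<⇒≤ (m%n<n k (order l)))) ⟩
          walk l (order l) j                       ≡⟨ act-relator (relator l) j ⟩
          j                                        ∎
          where open ≡-Reasoning

    rewriteWord-≈ : ∀ {u v} → u ≈ v → ∀ i → rewriteWord u i ∼ rewriteWord v i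
    rewriteWord-≈ ≈-refl        i = ∼-refl
    rewriteWord-≈ (≈-sym e)     i = ∼-sym (rewriteWord-≈ e i)
    rewriteWord-≈ (≈-trans e f) i = ∼-trans (rewriteWord-≈ e i) (rewriteWord-≈ f i)
    rewriteWord-≈ (≈-rel u v {w₁} {w₂} r) i = begin
      rewriteWord (u ++ w₁ ++ v) i                                   ≡⟨ split w₁ ⟩
      rewriteWord u i ++ rewriteWord w₁ (act u i) ++ rewriteWord v (act w₁ (act u i))
                        ≈⟨ ∼-congˡ (rewriteWord u i) (∼-cong-++ (relator∼ r (act u i))
                                                                 (≡⇒∼ (cong (rewriteWord v) (act-relator r (act u i))))) ⟩
      rewriteWord u i ++ rewriteWord w₂ (act u i) ++ rewriteWord v (act w₂ (act u i))   ≡⟨ split w₂ ⟨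
      rewriteWord (u ++ w₂ ++ v) i                                   ∎
      where
        open SetoidReasoning ∼-setoid
        split : ∀ w → rewriteWord (u ++ w ++ v) i
                    ≡ rewriteWord u i ++ rewriteWord w (act u i) ++ rewriteWord v (act w (act u i))
        split w = trans (rewriteWord-++ u (w ++ v) i) (cong (rewriteWord u i ++_) (rewriteWord-++ w v (act u i)))
        relator∼ : ∀ {w₁ w₂} → Rel w₁ w₂ → ∀ x → rewriteWord w₁ x ∼ rewriteWord w₂ x
        relator∼ rel-a = rewriteWord-relator a
        relator∼ rel-b = rewriteWord-relator b

    rewriteWord-inv : ∀ w i → rewriteWord (inv w) (act w i) ∼ invᶠ (rewriteWord w i)
    rewriteWord-inv w i = inverseʳ-unique (rewriteWord w i) _
      (∼-trans (≡⇒∼ (sym (rewriteWord-++ w (inv w) i))) (rewriteWord-≈ (inverseʳ w) i))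
      where open GroupProperties freeGroup using (inverseʳ-unique)

    pathFrom : ℕ → Fin (suc m) → Word
    pathFrom zero    j = []
    pathFrom (suc n) j with parent j
    ... | nothing      = []
    ... | just (i , l) = pathFrom n i ∷ʳ l

    transversal : Fin (suc m) → Word
    transversal j = pathFrom (suc (rank j)) j

    private
      parent-rank< : ∀ {n j i l} → rank j < suc n → parent j ≡ just (i , l) → rank i < n
      parent-rank< {n} j<n e = <-≤-trans (proj₁ (parent-just e)) (≤-pred j<n)

      pathFrom-stable : ∀ n n′ j → rank j < n → rank j < n′ → pathFrom n j ≡ pathFrom n′ j
      pathFrom-stable (suc n) (suc n′) j lt lt′ with parent j in e
      ... | nothing      = refl
      ... | just (i , l) = cong (_∷ʳ l) (pathFrom-stable n n′ i (parent-rank< lt e) (parent-rank< lt′ e))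

      pathFrom-act : ∀ n j → rank j < n → act (pathFrom n j) fzero ≡ j
      pathFrom-act (suc n) j lt with parent j in e
      ... | nothing      = sym (parent-nothing e)
      ... | just (i , l) = trans (act-++ (pathFrom n i) [ l ] fzero)
                                 (trans (cong (σ l) (pathFrom-act n i (parent-rank< lt e))) (proj₂ (parent-just e)))

      treeEdge⇒notFree : ∀ {i l} → T (isTreeEdge i l) → ¬ T (isFreeEdge i l)
      treeEdge⇒notFree {i} {l} tree with isTreeEdge i l
      ... | true = λ ()

      pathFrom-rewrite : ∀ n j → rank j < n → rewriteWord (pathFrom n j) fzero ∼ []
      pathFrom-rewrite (suc n) j lt with parent j in e
      ... | nothing      = ∼-refl
      ... | just (i , l) = ∼-trans (≡⇒∼ (rewriteWord-++ (pathFrom n i) [ l ] fzero))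
          (∼-trans (∼-congʳ _ (pathFrom-rewrite n i i<n)) (≡⇒∼ (begin
            letterImage (act (pathFrom n i) fzero) l ++ []    ≡⟨ cong (λ x → letterImage x l ++ []) (pathFrom-act n i i<n) ⟩
            letterImage i l ++ []                             ≡⟨ ++-identityʳ _ ⟩
            letterImage i l                                   ≡⟨ letterImage-notClosing (treeEdge⇒¬closing tree) ⟩
            edgeLetter i l                                    ≡⟨ edgeLetter-notFree i l (treeEdge⇒notFree tree) ⟩
            []                                                ∎)))
        where
          open ≡-Reasoning
          i<n = parent-rank< lt e
          tree : T (isTreeEdge i l)
          tree = parent⇒treeEdge (subst (λ x → parent x ≡ just (i , l)) (sym (proj₂ (parent-just e))) e)

    transversal-act : ∀ j → act (transversal j) fzero ≡ j
    transversal-act j = pathFrom-act (suc (rank j)) j ≤-refl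

    transversal-root : transversal fzero ≡ []
    transversal-root with parent fzero | parent-root
    ... | nothing | _ = refl

    transversal-treeEdge : ∀ {i l} → T (isTreeEdge i l) → transversal (σ l i) ≡ transversal i ∷ʳ l
    transversal-treeEdge {i} {l} tree
      with parent (σ l i) | treeEdge⇒parent tree | proj₁ (parent-just (treeEdge⇒parent tree))
    ... | just .(i , l) | refl | i<j = cong (_∷ʳ l) (pathFrom-stable (rank (σ l i)) (suc (rank i)) i i<j ≤-refl)

    transversal-rewrite : ∀ j → rewriteWord (transversal j) fzero ∼ []
    transversal-rewrite j = pathFrom-rewrite (suc (rank j)) j ≤-refl

    basis : FreeEdge → Word
    basis ((i , l) , _) = (transversal i ∷ʳ l) ++ inv (transversal (σ l i))

    private
      step-act : ∀ i l → act (transversal i ∷ʳ l) fzero ≡ act (transversal (σ l i)) fzero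
      step-act i l = trans (act-++ (transversal i) [ l ] fzero)
                           (trans (cong (σ l) (transversal-act i)) (sym (transversal-act (σ l i))))

      freeEdge⇒notClosing : ∀ {i l} → T (isFreeEdge i l) → ¬ T (isClosingEdge i l)
      freeEdge⇒notClosing {i} {l} free with isTreeEdge i l | isClosingEdge i l
      ... | false | false = λ ()

    basis-Stab : ∀ x → Stab (basis x)
    basis-Stab ((i , l) , _) = trans (act-++ (transversal i ∷ʳ l) (inv (transversal (σ l i))) fzero)
      (trans (cong (act (inv (transversal (σ l i)))) (step-act i l)) (act-inv-act (transversal (σ l i)) fzero))

    rewriteWord-basis : ∀ x → rewriteWord (basis x) fzero ∼ [ x , true ]
    rewriteWord-basis x@((i , l) , free) = begin
      rewriteWord ((transversal i ∷ʳ l) ++ inv (transversal j)) fzero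
          ≡⟨ rewriteWord-++ (transversal i ∷ʳ l) (inv (transversal j)) fzero ⟩
      rewriteWord (transversal i ∷ʳ l) fzero ++ rewriteWord (inv (transversal j)) (act (transversal i ∷ʳ l) fzero)
          ≡⟨ cong₂ _++_ (rewriteWord-++ (transversal i) [ l ] fzero)
                        (cong (rewriteWord (inv (transversal j))) (step-act i l)) ⟩
      (rewriteWord (transversal i) fzero ++ (letterImage (act (transversal i) fzero) l ++ []))
        ++ rewriteWord (inv (transversal j)) (act (transversal j) fzero)
          ≈⟨ ∼-cong-++ (∼-cong-++ (transversal-rewrite i) (≡⇒∼ letter))
                       (∼-trans (rewriteWord-inv (transversal j) fzero) (invᶠ-cong (transversal-rewrite j))) ⟩
      [ x , true ] ++ []
          ≡⟨ ++-identityʳ _ ⟩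
      [ x , true ] ∎
      where
        open SetoidReasoning ∼-setoid
        open Group freeGroup using () renaming (⁻¹-cong to invᶠ-cong)
        j = σ l i
        letter : letterImage (act (transversal i) fzero) l ++ [] ≡ [ x , true ]
        letter = trans (cong (λ y → letterImage y l ++ []) (transversal-act i))
          (trans (++-identityʳ _) (trans (letterImage-notClosing (freeEdge⇒notClosing free)) (edgeLetter-free i l free)))

    open Extension p₀ q₀ basis using (ext-++; ext-invᶠ)

    rewriteWord-ext : ∀ u → rewriteWord (ext basis u) fzero ∼ u
    rewriteWord-ext [] = ∼-refl
    rewriteWord-ext ((x , true) ∷ u) = ∼-trans (≡⇒∼ (rewriteWord-++ (basis x) (ext basis u) fzero))
      (∼-cong-++ (rewriteWord-basis x)
                 (subst (λ i → rewriteWord (ext basis u) i ∼ u) (sym (basis-Stab x)) (rewriteWord-ext u)))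
    rewriteWord-ext ((x , false) ∷ u) = ∼-trans (≡⇒∼ (rewriteWord-++ (inv (basis x)) (ext basis u) fzero))
      (∼-cong-++ (∼-trans (≡⇒∼ (cong (rewriteWord (inv (basis x))) (sym (basis-Stab x))))
                   (∼-trans (rewriteWord-inv (basis x) fzero) (invᶠ-cong (rewriteWord-basis x))))
                 (subst (λ i → rewriteWord (ext basis u) i ∼ u) (sym (Stab-inv {basis x} (basis-Stab x)))
                        (rewriteWord-ext u)))
      where
        open Group freeGroup using () renaming (⁻¹-cong to invᶠ-cong)
        open IsSubgroup Stab-isSubgroup using () renaming (inver to Stab-inv)

    ext-basis-injective : ∀ u → Reduced u → ext basis u ≈ [] → u ≡ []
    ext-basis-injective u red e =
      reduced-∼[] (Reduced⇒IsReduced {suc p₀} {suc q₀} u red)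
                  (∼-trans (∼-sym (rewriteWord-ext u)) (rewriteWord-≈ e fzero))
      where open Normalisation _≟ᴱ_

    private
      transversal-step-notClosing : ∀ i l → ¬ T (isClosingEdge i l) →
        (transversal i ∷ʳ l) ≈ (ext basis (letterImage i l) ++ transversal (σ l i))
      transversal-step-notClosing i l notClosing rewrite letterImage-notClosing notClosing
        with T? (isTreeEdge i l)
      ... | yes tree = subst (λ w → (transversal i ∷ʳ l) ≈ (ext basis w ++ transversal (σ l i)))
                         (sym (edgeLetter-notFree i l (treeEdge⇒notFree tree))) (≡⇒≈ (sym (transversal-treeEdge tree)))
      ... | no notTree = subst (λ w → (transversal i ∷ʳ l) ≈ (ext basis w ++ transversal (σ l i)))
                         (sym (edgeLetter-free i l free))
                         (≈-sym (≈-trans (≡⇒≈ (cong (_++ transversal (σ l i)) (++-identityʳ (basis x))))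
                                         (//-rightDividesˡ (transversal (σ l i)) (transversal i ∷ʳ l))))
        where
          open GroupProperties Δ-group using (//-rightDividesˡ)
          free : T (isFreeEdge i l)
          free with isTreeEdge i l | isClosingEdge i l
          ... | false | false = _
          ... | true  | _     = ⊥-elim (notTree _)
          ... | false | true  = ⊥-elim (notClosing _)
          x : FreeEdge
          x = (i , l) , free

      transversal-cyclePath : ∀ l k x → (∀ j → j < k → ¬ T (isClosingEdge (walk l j x) l)) →
        (transversal x ++ replicate k l) ≈ (ext basis (cyclePath l x k) ++ transversal (walk l k x))
      transversal-cyclePath l zero    x _ = ≡⇒≈ (++-identityʳ (transversal x))
      transversal-cyclePath l (suc k) x notClosing = begin
        transversal x ++ l ∷ replicate k l                           ≡⟨ ++-assoc (transversal x) [ l ] _ ⟨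
        (transversal x ∷ʳ l) ++ replicate k l                        ≈⟨ ≈-congʳ _ (transversal-step-notClosing x l (notClosing 0 (s≤s z≤n))) ⟩
        (ext basis (letterImage x l) ++ transversal (σ l x)) ++ replicate k l
                                                                     ≡⟨ cong (λ w → (ext basis w ++ transversal (σ l x)) ++ replicate k l)
                                                                             (letterImage-notClosing (notClosing 0 (s≤s z≤n))) ⟩
        (ext basis (edgeLetter x l) ++ transversal (σ l x)) ++ replicate k l
                                                                     ≡⟨ ++-assoc (ext basis (edgeLetter x l)) _ _ ⟩
        ext basis (edgeLetter x l) ++ (transversal (σ l x) ++ replicate k l)
                        ≈⟨ ≈-congˡ (ext basis (edgeLetter x l))
                                   (transversal-cyclePath l k (σ l x) (λ j j<k → notClosing (suc j) (s≤s j<k))) ⟩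
        ext basis (edgeLetter x l) ++ (ext basis (cyclePath l (σ l x) k) ++ transversal (walk l k (σ l x)))
                                                                     ≡⟨ ++-assoc (ext basis (edgeLetter x l)) _ _ ⟨
        (ext basis (edgeLetter x l) ++ ext basis (cyclePath l (σ l x) k)) ++ transversal (walk l k (σ l x))
                                                                     ≡⟨ cong (_++ transversal (walk l k (σ l x))) (ext-++ (edgeLetter x l) _) ⟨
        ext basis (cyclePath l x (suc k)) ++ transversal (walk l (suc k) x)   ∎
        where open SetoidReasoning (Group.setoid Δ-group)

      transversal-step-closing : ∀ i l → T (isClosingEdge i l) →
        (transversal i ∷ʳ l) ≈ (ext basis (letterImage i l) ++ transversal (σ l i))
      transversal-step-closing i l closing rewrite letterImage-closing closing = begin
        transversal i ∷ʳ l                                                  ≈⟨ ≈-congʳ [ l ] t-i ⟩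
        (inv (ext basis C) ++ (transversal r ++ replicate (order₀ l) l)) ∷ʳ l
                           ≡⟨ trans (++-assoc (inv (ext basis C)) _ [ l ])
                                    (cong (inv (ext basis C) ++_) (trans (++-assoc (transversal r) _ [ l ])
                                      (cong (transversal r ++_) (replicate-∷ʳ (order₀ l) l)))) ⟩
        inv (ext basis C) ++ (transversal r ++ replicate (order l) l)     ≈⟨ ≈-congˡ _ (≈-trans (≈-congˡ (transversal r) (relator⇒≈ (relator l)))
                                                                                              (≡⇒≈ (++-identityʳ (transversal r)))) ⟩
        inv (ext basis C) ++ transversal r                                ≈⟨ ≈-congʳ (transversal r) (ext-invᶠ C) ⟨
        ext basis (invᶠ C) ++ transversal r                               ∎
        where
          open SetoidReasoning (Group.setoid Δ-group)
          open GroupProperties Δ-group using (y≈x\\z)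
          r = σ l i
          C = cyclePath l r (order₀ l)
          r-min : cycleMin l r ≡ r
          r-min = sym (toWitness {a? = σ l i ≟ cycleMin l (σ l i)} closing)
          path : (transversal r ++ replicate (order₀ l) l) ≈ (ext basis C ++ transversal i)
          path = subst (λ j → (transversal r ++ replicate (order₀ l) l) ≈ (ext basis C ++ transversal j))
            (walk-order₀-σ l i) (transversal-cyclePath l (order₀ l) r (noClosingEdge-before-min l r r-min))
          t-i : transversal i ≈ (inv (ext basis C) ++ (transversal r ++ replicate (order₀ l) l))
          t-i = y≈x\\z (ext basis C) (transversal i) _ (≈-sym path)

    transversal-step : ∀ i l → (transversal i ∷ʳ l) ≈ (ext basis (letterImage i l) ++ transversal (σ l i))
    transversal-step i l = by-cases (T? (isClosingEdge i l))
      where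
        by-cases : Dec (T (isClosingEdge i l)) →
                  (transversal i ∷ʳ l) ≈ (ext basis (letterImage i l) ++ transversal (σ l i))
        by-cases (yes closing)    = transversal-step-closing i l closing
        by-cases (no  notClosing) = transversal-step-notClosing i l notClosing

    transversal-++ : ∀ w i → (transversal i ++ w) ≈ (ext basis (rewriteWord w i) ++ transversal (act w i))
    transversal-++ []      i = ≡⇒≈ (++-identityʳ (transversal i))
    transversal-++ (l ∷ w) i = begin
      transversal i ++ l ∷ w                                              ≡⟨ ++-assoc (transversal i) [ l ] w ⟨
      (transversal i ∷ʳ l) ++ w                                           ≈⟨ ≈-congʳ w (transversal-step i l) ⟩
      (ext basis (letterImage i l) ++ transversal (σ l i)) ++ w           ≡⟨ ++-assoc (ext basis (letterImage i l)) _ w ⟩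
      ext basis (letterImage i l) ++ (transversal (σ l i) ++ w)           ≈⟨ ≈-congˡ (ext basis (letterImage i l)) (transversal-++ w (σ l i)) ⟩
      ext basis (letterImage i l) ++ (ext basis (rewriteWord w (σ l i)) ++ transversal (act w (σ l i)))
                                                                          ≡⟨ ++-assoc (ext basis (letterImage i l)) _ _ ⟨
      (ext basis (letterImage i l) ++ ext basis (rewriteWord w (σ l i))) ++ transversal (act w (σ l i))
                                                                          ≡⟨ cong (_++ transversal (act w (σ l i))) (ext-++ (letterImage i l) _) ⟨
      ext basis (rewriteWord (l ∷ w) i) ++ transversal (act (l ∷ w) i)   ∎
      where open SetoidReasoning (Group.setoid Δ-group)

    ext-basis-onto : ∀ w → Stab w → ∃ λ u → ext basis u ≈ w
    ext-basis-onto w s = rewriteWord w fzero , ≈-sym (begin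
      w                                                               ≡⟨ cong (_++ w) transversal-root ⟨
      transversal fzero ++ w                                          ≈⟨ transversal-++ w fzero ⟩
      ext basis (rewriteWord w fzero) ++ transversal (act w fzero)    ≡⟨ cong (λ j → ext basis (rewriteWord w fzero) ++ transversal j) s ⟩
      ext basis (rewriteWord w fzero) ++ transversal fzero            ≡⟨ cong (ext basis (rewriteWord w fzero) ++_) transversal-root ⟩
      ext basis (rewriteWord w fzero) ++ []                           ≡⟨ ++-identityʳ _ ⟩
      ext basis (rewriteWord w fzero)                                 ∎)
      where open SetoidReasoning (Group.setoid Δ-group)

    Stab-freeOfIndex : FreeSubgroupOfIndex (suc m)
    Stab-freeOfIndex = Stab , Stab-isSubgroup
      , ((λ u → act u fzero) , (λ j → transversal j , transversal-act j) , act-fzero≡⇔Stab)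
      , (FreeEdge , basis , basis-Stab , ext-basis-onto , ext-basis-injective)

-- Counting rooted hypermaps

module RootedHypermapCount (p₀ q₀ m : ℕ) where

  private
    Hypermap : Set
    Hypermap = PQHypermap (suc p₀) (suc q₀) m

    _≅_ : Hypermap → Hypermap → Set
    _≅_ = RootedIso (suc p₀) (suc q₀) (suc m)

    Endo : Set
    Endo = Fin (suc m) → Fin (suc m)

  fromPermutations : (α φ : Permutation′ (suc m)) → Maybe Hypermap
  fromPermutations α φ with AllCyclesLength? α (suc p₀) | AllCyclesLength? φ (suc q₀)
  ... | yes α-cycles | yes φ-cycles = Maybe.map (λ connected → record
          { α = α ; φ = φ ; connected = connected ; α-cycles = α-cycles ; φ-cycles = φ-cycles })
          (dec⇒maybe (BreadthFirstSearch.transitive? p₀ q₀ m α φ α-cycles φ-cycles))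
  ... | _ | _ = nothing

  candidate : Endo × Endo → Maybe Hypermap
  candidate (f , g) with injective? f | injective? g
  ... | yes f-inj | yes g-inj = fromPermutations (injective⇒permutation f f-inj) (injective⇒permutation g g-inj)
  ... | _ | _ = nothing

  module _ (M : Hypermap) where
    open PQHypermap M

    fromPermutations-complete : ∀ α′ φ′ → (∀ i → α′ ⟨$⟩ʳ i ≡ α ⟨$⟩ʳ i) → (∀ i → φ′ ⟨$⟩ʳ i ≡ φ ⟨$⟩ʳ i) →
                                MaybeAny.Any (M ≅_) (fromPermutations α′ φ′)
    fromPermutations-complete α′ φ′ eα eφ with AllCyclesLength? α′ (suc p₀) | AllCyclesLength? φ′ (suc q₀)
    ... | no ¬cycles | _ = ⊥-elim (¬cycles (AllCyclesLength-cong α α′ (sym ∘ eα) α-cycles))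
    ... | yes _ | no ¬cycles = ⊥-elim (¬cycles (AllCyclesLength-cong φ φ′ (sym ∘ eφ) φ-cycles))
    ... | yes α′-cycles | yes φ′-cycles with BreadthFirstSearch.transitive? p₀ q₀ m α′ φ′ α′-cycles φ′-cycles
    ...   | yes _ = MaybeAny.just (Perm.id , refl , sym ∘ eα , sym ∘ eφ)
    ...   | no ¬connected = ⊥-elim (¬connected (Transitive-cong α φ α′ φ′ (sym ∘ eα) (sym ∘ eφ) connected))

    candidate-complete : ∀ f g → (∀ i → f i ≡ α ⟨$⟩ʳ i) → (∀ i → g i ≡ φ ⟨$⟩ʳ i) →
                         MaybeAny.Any (M ≅_) (candidate (f , g))
    candidate-complete f g ef eg with injective? f | injective? g
    ... | yes _ | yes _ = fromPermutations-complete _ _ ef eg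
    ... | no ¬inj | _ = ⊥-elim (¬inj (permutation-injective α ef))
    ... | yes _ | no ¬inj = ⊥-elim (¬inj (permutation-injective φ eg))

  allHypermaps : List Hypermap
  allHypermaps = mapMaybe candidate (cartesianProduct (allFunctions (suc m) (suc m)) (allFunctions (suc m) (suc m)))

  allHypermaps-complete : ∀ M → Any (M ≅_) allHypermaps
  allHypermaps-complete M =
    let f , f∈ , ef = find (allFunctions-complete _ _ (PQHypermap.α M ⟨$⟩ʳ_))
        g , g∈ , eg = find (allFunctions-complete _ _ (PQHypermap.φ M ⟨$⟩ʳ_))
    in Any.mapMaybe⁺ candidate _ (Any.map⁺ (lose (∈-cartesianProduct⁺ f∈ g∈) (candidate-complete M f g ef eg)))

  _≅?_ : ∀ H K → Dec (H ≅ K)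
  H ≅? K = map′ toIso fromIso (Any.any? isIsomorphism? (allFunctions (suc m) (suc m)))
    where
      module H = PQHypermap H
      module K = PQHypermap K
      IsIsomorphism : Endo → Set
      IsIsomorphism ψ = Injective ψ × ψ fzero ≡ fzero
                      × (∀ i → ψ (H.α ⟨$⟩ʳ i) ≡ K.α ⟨$⟩ʳ ψ i) × (∀ i → ψ (H.φ ⟨$⟩ʳ i) ≡ K.φ ⟨$⟩ʳ ψ i)
      isIsomorphism? : ∀ ψ → Dec (IsIsomorphism ψ)
      isIsomorphism? ψ = injective? ψ ×-dec ψ fzero ≟ fzero
                       ×-dec all? (λ i → ψ (H.α ⟨$⟩ʳ i) ≟ K.α ⟨$⟩ʳ ψ i)
                       ×-dec all? (λ i → ψ (H.φ ⟨$⟩ʳ i) ≟ K.φ ⟨$⟩ʳ ψ i)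
      toIso : Any IsIsomorphism (allFunctions (suc m) (suc m)) → H ≅ K
      toIso found = let ψ , inj , ψ0 , ψα , ψφ = Any.satisfied found in injective⇒permutation ψ inj , ψ0 , ψα , ψφ
      fromIso : H ≅ K → Any IsIsomorphism (allFunctions (suc m) (suc m))
      fromIso (π , π0 , πα , πφ) = Any.map (λ {ψ} ψ≗π →
          (λ {i} {j} → permutation-injective π ψ≗π {i} {j}) , trans (ψ≗π fzero) π0
        , (λ i → trans (ψ≗π _) (trans (πα i) (cong (K.α ⟨$⟩ʳ_) (sym (ψ≗π i)))))
        , (λ i → trans (ψ≗π _) (trans (πφ i) (cong (K.φ ⟨$⟩ʳ_) (sym (ψ≗π i))))))
        (allFunctions-complete _ _ (π ⟨$⟩ʳ_))

  open RootedIsomorphism p₀ q₀ m using (≅-refl; ≅-sym; ≅-trans)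

  rootedHypermapClasses : ∃ λ k → NumClasses (RootedHypermap (suc p₀) (suc q₀) (suc m)) _≅_ k
  rootedHypermapClasses = numClasses (record { refl = λ {H} → ≅-refl H ; sym = λ {H} {K} → ≅-sym {H} {K}
                                             ; trans = λ {H} {K} {J} → ≅-trans {H} {K} {J} }) _≅?_
                                     allHypermaps allHypermaps-complete

module Correspondence (p₀ q₀ m : ℕ) where
  open RootedIsomorphism p₀ q₀ m using (SameStab⇒≅; ≅⇒SameStab)

  private
    Subgroup = Δ.FreeSubgroupOfIndex (suc p₀) (suc q₀) (suc m)
    Hypermap = PQHypermap (suc p₀) (suc q₀) m

  cosetHypermap : Subgroup → Hypermap
  cosetHypermap = CosetHypermap.cosetHypermap p₀ q₀ m

  stabiliser : Hypermap → Subgroup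
  stabiliser M = Schreier.Stab-freeOfIndex p₀ q₀ m M
    (BreadthFirstSearch.spanningTree p₀ q₀ m α φ α-cycles φ-cycles connected)
    where open PQHypermap M

  cosetHypermap-stabiliser : ∀ M → RootedIso (suc p₀) (suc q₀) (suc m) (cosetHypermap (stabiliser M)) M
  cosetHypermap-stabiliser M =
    SameStab⇒≅ (cosetHypermap (stabiliser M)) M (CosetHypermap.Stab⇔H p₀ q₀ m (stabiliser M))

  cosetHypermap-≅⇔ : ∀ S T →
    RootedIso (suc p₀) (suc q₀) (suc m) (cosetHypermap S) (cosetHypermap T) ⇔ Δ.SameSubgroup (suc p₀) (suc q₀) S T
  cosetHypermap-≅⇔ S T = mk⇔
    (λ iso w → Equiv.trans (Equiv.sym (Stab⇔H S w))
                 (Equiv.trans (≅⇒SameStab (cosetHypermap S) (cosetHypermap T) iso w) (Stab⇔H T w)))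
    (λ same → SameStab⇒≅ (cosetHypermap S) (cosetHypermap T) λ w →
                 Equiv.trans (Stab⇔H S w) (Equiv.trans (same w) (Equiv.sym (Stab⇔H T w))))
    where Stab⇔H = CosetHypermap.Stab⇔H p₀ q₀ m

theorem4p2 : (p q : ℕ) → 6 ≤ p * q → (n : ℕ) →
    Σ ℕ (λ k →
    NumClasses (Δ.FreeSubgroupOfIndex p q n) (Δ.SameSubgroup p q) k ×
    NumClasses (RootedHypermap p q n) (RootedIso p q n) k)
-- 6 ≤ p q only serves to exclude p = 0 and q = 0.
theorem4p2 zero     q        ()
theorem4p2 (suc p₀) zero     6≤pq = ⊥-elim (n≮0 (subst (5 <_) (*-zeroʳ (suc p₀)) 6≤pq))
theorem4p2 (suc p₀) (suc q₀) _ zero =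
  0 , NumClasses-empty (λ S → noIndex (proj₁ (proj₁ (proj₂ (proj₂ S))) [])) , NumClasses-empty λ ()
  where
    noIndex : ¬ Fin 0
    noIndex ()
theorem4p2 (suc p₀) (suc q₀) _ (suc m) =
  let k , hypermapClasses = RootedHypermapCount.rootedHypermapClasses p₀ q₀ m in
  k , NumClasses-transfer cosetHypermap (λ M → stabiliser M , cosetHypermap-stabiliser M) cosetHypermap-≅⇔
                          hypermapClasses
    , hypermapClasses
  where open Correspondence p₀ q₀ m
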